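{- Let $0<|q|<1$, let $r,s\ge 0$ be integers, and let $a,b,c$ be nonzero complex numbers such that all denominators below are nonzero. Then $$\frac{1+b}{c+b}\sum_{k=0}^{r}\begin{bmatrix}r+s-k\\ r-k\end{bmatrix}_q\frac{(c,aq^{ -s}/b;q)_k}{(-aq,-cq/b;q)_k}q^{(s+1)k}-\frac{1+a}{c+a}\sum_{k=0}^{s}\begin{bmatrix}r+s-k\\ s-k\end{bmatrix}_q\frac{(c,bq^{ -r}/a;q)_k}{(-bq,-cq/a;q)_k}q^{(r+1)k}$$ $$=\left(\frac{1}{b}-\frac{1}{a}\right)\frac{(aq/b;q)_r(bq/a;q)_s(c;q)_{1+r+s}}{(-aq;q)_r(-bq;q)_s(-c/b;q)_{r+1}(-c/a;q)_{s+1}}.$$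
   Context: For complex $x$ and integer $n\ge 0$: $(x;q)_n=\prod_{j=0}^{n-1}(1-xq^j)$ and $(x_1,\dots,x_m;q)_n=(x_1;q)_n\cdots(x_m;q)_n$. The $q$-binomial coefficient is $\begin{bmatrix}n\\ k\end{bmatrix}_q=\frac{(q;q)_n}{(q;q)_k(q;q)_{n-k}}$. -}

module Defs where

open import Level using (Level; _⊔_) renaming (suc to lsuc)
open import Data.Nat using (ℕ; zero; suc; _∸_)
open import Relation.Nullary using (¬_)
open import Algebra.Bundles using (CommutativeRing)

-- A field: a commutative ring with 0 ≠ 1 and a (total) inversion map that is
-- a genuine inverse on every nonzero element (the value at 0 is irrelevant).
record Field (c ℓ : Level) : Set (lsuc (c ⊔ ℓ)) where
  field
    commutativeRing : CommutativeRing c ℓ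
  open CommutativeRing commutativeRing public
  field
    _⁻¹     : Carrier → Carrier
    0≉1     : ¬ (0# ≈ 1#)
    ⁻¹-inverse : ∀ x → ¬ (x ≈ 0#) → x * (x ⁻¹) ≈ 1#

module FieldOps {c ℓ : Level} (F : Field c ℓ) where
  open Field F

  infixl 7 _/_
  _/_ : Carrier → Carrier → Carrier
  x / y = x * (y ⁻¹)

  infixr 8 _^_
  _^_ : Carrier → ℕ → Carrier
  x ^ zero  = 1#
  x ^ suc n = x * (x ^ n)

  poch : Carrier → Carrier → ℕ → Carrier
  poch x q zero    = 1#
  poch x q (suc n) = poch x q n * (1# - x * (q ^ n))

  -- q-binomial coefficient [n choose k]_q = (q;q)_n / ((q;q)_k (q;q)_{n-k})
  -- (only used with k ≤ n).
  qbinom : Carrier → ℕ → ℕ → Carrier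
  qbinom q n k = poch q q n / (poch q q k * poch q q (n ∸ k))

  sumTo : ℕ → (ℕ → Carrier) → Carrier
  sumTo zero    f = f 0
  sumTo (suc n) f = sumTo n f + f (suc n)

module Submission where

-- Both sides satisfy the same
-- first-order recurrence in r (and, by the symmetry a ↔ b, r ↔ s, in s):
--   (1 + a y)(1 + c y/b) X(r+1, s) = (1 - a y/b)(1 - c q^{r+s+1}) X(r, s),   y = q^{r+1}.
-- For R this is read off from the q-Pochhammer symbols.  For L, each of the two sums
-- satisfies an inhomogeneous version of the recurrence, proved by creative telescoping
-- with an explicit certificate (one for a step of the summation bound r, one for a step
-- of the parameter s); the two inhomogeneous terms cancel by the symmetry of the
-- q-binomial coefficient.  The corollary then follows by induction on r, and on s for
-- r = 0, from the case r = s = 0.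

open import Defs
open import Level using (Level)
open import Data.Nat using (ℕ; _≤_; _∸_) renaming (_+_ to _+ℕ_; _*_ to _*ℕ_)
open import Relation.Nullary using (¬_)

open import Algebra.Bundles using (CommutativeRing; RawRing)
open import Data.Nat as ℕ using (zero; suc; _<_; z≤n; s≤s)
import Data.Nat.Properties as ℕₚ
open import Data.Product using (_×_; _,_)
open import Data.Sum using (inj₁; inj₂)
open import Data.Maybe using (nothing)
open import Relation.Binary.PropositionalEquality as ≡ using (_≡_)
open import Data.Vec using (Vec)
open import Tactic.RingSolver.Core.AlmostCommutativeRing using (fromCommutativeRing)
open import Tactic.RingSolver.Core.Polynomial.Parameters using (Homomorphism)
open import Tactic.RingSolver.Core.Expression

-- The standard library's non-reflective solver uses the ring itself as the
-- coefficient ring, where it cannot recognise cancellation (1 - 1 = 0) in an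
-- arbitrary ring; here coefficients are integers m - n, represented by pairs
-- (m , n) of naturals kept in the canonical form with one component zero.
module IntegerRingSolver {c ℓ : Level} (R : CommutativeRing c ℓ) where
  open CommutativeRing R
  open import Relation.Binary.Reasoning.Setoid setoid
  open import Algebra.Properties.Ring ring using (-‿involutive; -‿distribˡ-*; -‿distribʳ-*; -‿+-comm; -0#≈0#)

  ℤ₂ : Set
  ℤ₂ = ℕ × ℕ

  canon : ℕ → ℕ → ℤ₂
  canon m n = (m ℕ.∸ n , n ℕ.∸ m)

  ℤ₂-ring : RawRing _ _
  ℤ₂-ring = record
    { Carrier = ℤ₂
    ; _≈_ = _≡_
    ; _+_ = λ { (m , n) (m' , n') → canon (m ℕ.+ m') (n ℕ.+ n') }
    ; _*_ = λ { (m , n) (m' , n') → canon (m ℕ.* m' ℕ.+ n ℕ.* n') (m ℕ.* n' ℕ.+ n ℕ.* m') }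
    ; -_ = λ { (m , n) → (n , m) }
    ; 0# = (0 , 0)
    ; 1# = (1 , 0)
    }

  nat : ℕ → Carrier
  nat zero = 0#
  nat (suc n) = 1# + nat n

  -- Interpretation of a coefficient; 0 and 1 are mapped to 0# and 1# on the
  -- nose, so that literal constants in solver expressions evaluate as written.
  ⟦_⟧ℤ : ℤ₂ → Carrier
  ⟦ 0 , 0 ⟧ℤ = 0#
  ⟦ 1 , 0 ⟧ℤ = 1#
  ⟦ m , n ⟧ℤ = nat m - nat n

  ⟦⟧ℤ-correct : ∀ m n → ⟦ m , n ⟧ℤ ≈ nat m - nat n
  ⟦⟧ℤ-correct 0 0 = sym (trans (+-identityˡ _) -0#≈0#)
  ⟦⟧ℤ-correct 1 0 = sym (trans (+-cong (+-identityʳ 1#) -0#≈0#) (+-identityʳ 1#))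
  ⟦⟧ℤ-correct 0 (suc n) = refl
  ⟦⟧ℤ-correct 1 (suc n) = refl
  ⟦⟧ℤ-correct (suc (suc m)) n = refl

  nat-+ : ∀ m n → nat (m ℕ.+ n) ≈ nat m + nat n
  nat-+ zero n = sym (+-identityˡ _)
  nat-+ (suc m) n = trans (+-congˡ (nat-+ m n)) (sym (+-assoc _ _ _))

  nat-* : ∀ m n → nat (m ℕ.* n) ≈ nat m * nat n
  nat-* zero n = sym (zeroˡ _)
  nat-* (suc m) n = begin
    nat (n ℕ.+ m ℕ.* n)         ≈⟨ trans (nat-+ n (m ℕ.* n)) (+-congˡ (nat-* m n)) ⟩
    nat n + nat m * nat n        ≈⟨ +-congʳ (sym (*-identityˡ _)) ⟩
    1# * nat n + nat m * nat n   ≈⟨ sym (distribʳ _ _ _) ⟩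
    (1# + nat m) * nat n         ∎

  sub-+ : ∀ a b c d → (a - b) + (c - d) ≈ (a + c) - (b + d)
  sub-+ a b c d = begin
    (a - b) + (c - d)     ≈⟨ +-assoc _ _ _ ⟩
    a + (- b + (c - d))   ≈⟨ +-congˡ (trans (sym (+-assoc _ _ _)) (+-congʳ (+-comm _ _))) ⟩
    a + ((c - b) - d)     ≈⟨ +-congˡ (+-assoc _ _ _) ⟩
    a + (c + (- b - d))   ≈⟨ sym (+-assoc _ _ _) ⟩
    (a + c) + (- b - d)   ≈⟨ +-congˡ (-‿+-comm b d) ⟩
    (a + c) - (b + d)     ∎

  sub-* : ∀ a b c d → (a - b) * (c - d) ≈ (a * c + b * d) - (a * d + b * c)
  sub-* a b c d = begin
    (a - b) * (c - d)                     ≈⟨ trans (distribʳ _ _ _) (+-cong (distribˡ _ _ _) (distribˡ _ _ _)) ⟩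
    (a * c + a * - d) + (- b * c + - b * - d)
      ≈⟨ +-cong (+-congˡ (sym (-‿distribʳ-* a d)))
                (+-cong (sym (-‿distribˡ-* b c)) (trans (sym (-‿distribˡ-* b (- d)))
                  (trans (-‿cong (sym (-‿distribʳ-* b d))) (-‿involutive _)))) ⟩
    (a * c - a * d) + (- (b * c) + b * d) ≈⟨ +-congˡ (+-comm _ _) ⟩
    (a * c - a * d) + (b * d - b * c)     ≈⟨ sub-+ _ _ _ _ ⟩
    (a * c + b * d) - (a * d + b * c)     ∎

  canon-correct : ∀ m n → ⟦ canon m n ⟧ℤ ≈ nat m - nat n
  canon-correct m n = trans (⟦⟧ℤ-correct (m ℕ.∸ n) (n ℕ.∸ m)) (go m n)
    where
    go : ∀ m n → nat (m ℕ.∸ n) - nat (n ℕ.∸ m) ≈ nat m - nat n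
    go zero zero = refl
    go zero (suc n) = refl
    go (suc m) zero = refl
    go (suc m) (suc n) = trans (go m n) (sym (begin
      (1# + nat m) - (1# + nat n)  ≈⟨ sym (sub-+ 1# 1# (nat m) (nat n)) ⟩
      (1# - 1#) + (nat m - nat n)  ≈⟨ +-congʳ (-‿inverseʳ 1#) ⟩
      0# + (nat m - nat n)         ≈⟨ +-identityˡ _ ⟩
      nat m - nat n                ∎))

  homomorphism : Homomorphism _ _ _ _
  homomorphism = record
    { from = record { rawRing = ℤ₂-ring ; isZero = λ { (m , n) → m ℕ.≡ᵇ n } }
    ; to = fromCommutativeRing R (λ _ → nothing)
    ; morphism = record
      { ⟦_⟧ = ⟦_⟧ℤ
      ; +-homo = λ { (m , n) (m' , n') → begin
          ⟦ canon (m ℕ.+ m') (n ℕ.+ n') ⟧ℤ       ≈⟨ canon-correct (m ℕ.+ m') (n ℕ.+ n') ⟩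
          nat (m ℕ.+ m') - nat (n ℕ.+ n')        ≈⟨ +-cong (nat-+ m m') (-‿cong (nat-+ n n')) ⟩
          (nat m + nat m') - (nat n + nat n')    ≈⟨ sym (sub-+ _ _ _ _) ⟩
          (nat m - nat n) + (nat m' - nat n')    ≈⟨ sym (+-cong (⟦⟧ℤ-correct m n) (⟦⟧ℤ-correct m' n')) ⟩
          ⟦ m , n ⟧ℤ + ⟦ m' , n' ⟧ℤ             ∎ }
      ; *-homo = λ { (m , n) (m' , n') → begin
          ⟦ canon (m ℕ.* m' ℕ.+ n ℕ.* n') (m ℕ.* n' ℕ.+ n ℕ.* m') ⟧ℤ
            ≈⟨ canon-correct (m ℕ.* m' ℕ.+ n ℕ.* n') (m ℕ.* n' ℕ.+ n ℕ.* m') ⟩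
          nat (m ℕ.* m' ℕ.+ n ℕ.* n') - nat (m ℕ.* n' ℕ.+ n ℕ.* m')
            ≈⟨ +-cong (trans (nat-+ (m ℕ.* m') (n ℕ.* n')) (+-cong (nat-* m m') (nat-* n n')))
                      (-‿cong (trans (nat-+ (m ℕ.* n') (n ℕ.* m')) (+-cong (nat-* m n') (nat-* n m')))) ⟩
          (nat m * nat m' + nat n * nat n') - (nat m * nat n' + nat n * nat m')
            ≈⟨ sym (sub-* _ _ _ _) ⟩
          (nat m - nat n) * (nat m' - nat n')   ≈⟨ sym (*-cong (⟦⟧ℤ-correct m n) (⟦⟧ℤ-correct m' n')) ⟩
          ⟦ m , n ⟧ℤ * ⟦ m' , n' ⟧ℤ              ∎ }
      ; -‿homo = λ { (m , n) → begin
          ⟦ n , m ⟧ℤ            ≈⟨ ⟦⟧ℤ-correct n m ⟩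
          nat n - nat m         ≈⟨ +-comm _ _ ⟩
          - nat m + nat n       ≈⟨ +-congˡ (sym (-‿involutive _)) ⟩
          - nat m - - nat n     ≈⟨ -‿+-comm _ _ ⟩
          - (nat m - nat n)     ≈⟨ -‿cong (sym (⟦⟧ℤ-correct m n)) ⟩
          - ⟦ m , n ⟧ℤ          ∎ }
      ; 0-homo = refl
      ; 1-homo = refl
      }
    ; Zero-C⟶Zero-R = λ { (m , n) m≡n → sym (begin
        ⟦ m , n ⟧ℤ      ≈⟨ ⟦⟧ℤ-correct m n ⟩
        nat m - nat n   ≈⟨ +-congʳ (reflexive (≡.cong nat (ℕₚ.≡ᵇ⇒≡ m n m≡n))) ⟩
        nat n - nat n   ≈⟨ -‿inverseʳ (nat n) ⟩
        0#              ∎) }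
    }

  open Eval rawRing ⟦_⟧ℤ public
  open import Tactic.RingSolver.Core.Polynomial.Base (Homomorphism.from homomorphism)

  normalise : ∀ {n} → Expr ℤ₂ n → Poly n
  normalise (Κ x)   = κ x
  normalise (Ι x)   = ι x
  normalise (x ⊕ y) = normalise x ⊞ normalise y
  normalise (x ⊗ y) = normalise x ⊠ normalise y
  normalise (⊝ x)   = ⊟ normalise x
  normalise (x ⊛ i) = normalise x ⊡ i

  ⟦_⇓⟧ : ∀ {n} → Expr ℤ₂ n → Vec Carrier n → Carrier
  ⟦ e ⇓⟧ = ⟦ normalise e ⟧ₚ
    where open import Tactic.RingSolver.Core.Polynomial.Semantics homomorphism renaming (⟦_⟧ to ⟦_⟧ₚ)

  normalise-correct : ∀ {n} (e : Expr ℤ₂ n) ρ → ⟦ e ⇓⟧ ρ ≈ ⟦ e ⟧ ρ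
  normalise-correct {n} = go
    where
    open import Tactic.RingSolver.Core.Polynomial.Homomorphism homomorphism
    open import Algebra.Properties.Semiring.Exp.TCOptimised semiring
    go : ∀ (e : Expr ℤ₂ n) ρ → ⟦ e ⇓⟧ ρ ≈ ⟦ e ⟧ ρ
    go (Κ x)   ρ = κ-hom x ρ
    go (Ι x)   ρ = ι-hom x ρ
    go (x ⊕ y) ρ = trans (⊞-hom (normalise x) (normalise y) ρ) (+-cong (go x ρ) (go y ρ))
    go (x ⊗ y) ρ = trans (⊠-hom (normalise x) (normalise y) ρ) (*-cong (go x ρ) (go y ρ))
    go (⊝ x)   ρ = trans (⊟-hom (normalise x) ρ) (-‿cong (go x ρ))
    go (x ⊛ i) ρ = trans (⊡-hom (normalise x) i ρ) (^-congˡ i (go x ρ))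

  open import Relation.Binary.Reflection setoid Ι ⟦_⟧ ⟦_⇓⟧ normalise-correct public using (solve; _⊜_)

  infixl 6 _⊖_
  _⊖_ : ∀ {n} → Expr ℤ₂ n → Expr ℤ₂ n → Expr ℤ₂ n
  x ⊖ y = x ⊕ ⊝ y

  𝟘 𝟙 : ∀ {n} → Expr ℤ₂ n
  𝟘 = Κ (0 , 0)
  𝟙 = Κ (1 , 0)


module FieldLemmas {ℓc ℓe : Level} (F : Field ℓc ℓe) where
  open Field F
  open FieldOps F
  open IntegerRingSolver commutativeRing public
  open import Relation.Binary.Reasoning.Setoid setoid

  infix 4 _≉0
  _≉0 : Carrier → Set ℓe
  x ≉0 = ¬ (x ≈ 0#)

  ≉0-resp : ∀ {x y} → x ≈ y → x ≉0 → y ≉0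
  ≉0-resp x≈y x≉0 y≈0 = x≉0 (trans x≈y y≈0)

  1≉0 : 1# ≉0
  1≉0 1≈0 = 0≉1 (sym 1≈0)

  inverseˡ : ∀ {x} → x ≉0 → x ⁻¹ * x ≈ 1#
  inverseˡ {x} x≉0 = trans (*-comm _ _) (⁻¹-inverse x x≉0)

  *-≉0 : ∀ {x y} → x ≉0 → y ≉0 → x * y ≉0
  *-≉0 {x} {y} x≉0 y≉0 xy≈0 = y≉0 (begin
    y                ≈⟨ sym (trans (*-congʳ (inverseˡ x≉0)) (*-identityˡ y)) ⟩
    (x ⁻¹ * x) * y   ≈⟨ trans (*-assoc _ _ _) (*-congˡ xy≈0) ⟩
    x ⁻¹ * 0#        ≈⟨ zeroʳ _ ⟩
    0#               ∎)

  *-≉0ˡ : ∀ {x y} → x * y ≉0 → x ≉0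
  *-≉0ˡ xy≉0 x≈0 = xy≉0 (trans (*-congʳ x≈0) (zeroˡ _))

  *-≉0ʳ : ∀ {x y} → x * y ≉0 → y ≉0
  *-≉0ʳ xy≉0 y≈0 = xy≉0 (trans (*-congˡ y≈0) (zeroʳ _))

  *-cancelʳ : ∀ {x y d} → d ≉0 → x * d ≈ y * d → x ≈ y
  *-cancelʳ {x} {y} {d} d≉0 xd≈yd = begin
    x                  ≈⟨ sym (trans (*-congˡ (⁻¹-inverse d d≉0)) (*-identityʳ x)) ⟩
    x * (d * d ⁻¹)     ≈⟨ sym (*-assoc _ _ _) ⟩
    (x * d) * d ⁻¹     ≈⟨ *-congʳ xd≈yd ⟩
    (y * d) * d ⁻¹     ≈⟨ *-assoc _ _ _ ⟩
    y * (d * d ⁻¹)     ≈⟨ trans (*-congˡ (⁻¹-inverse d d≉0)) (*-identityʳ y) ⟩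
    y                  ∎

  ⁻¹-unique : ∀ {d e} → d ≉0 → d * e ≈ 1# → d ⁻¹ ≈ e
  ⁻¹-unique {d} {e} d≉0 de≈1 = *-cancelʳ d≉0 (trans (inverseˡ d≉0) (trans (sym de≈1) (*-comm d e)))

  -- inversion is only a congruence on nonzero elements
  ⁻¹-cong : ∀ {x y} → x ≈ y → x ≉0 → x ⁻¹ ≈ y ⁻¹
  ⁻¹-cong x≈y x≉0 = ⁻¹-unique x≉0 (trans (*-congʳ x≈y) (⁻¹-inverse _ (≉0-resp x≈y x≉0)))

  ⁻¹-* : ∀ {x y} → x * y ≉0 → (x * y) ⁻¹ ≈ x ⁻¹ * y ⁻¹
  ⁻¹-* {x} {y} xy≉0 = ⁻¹-unique xy≉0 (begin
    (x * y) * (x ⁻¹ * y ⁻¹)   ≈⟨ solve 4 (λ x y x' y' → (x ⊗ y) ⊗ (x' ⊗ y') ⊜ (x ⊗ x') ⊗ (y ⊗ y')) refl x y (x ⁻¹) (y ⁻¹) ⟩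
    (x * x ⁻¹) * (y * y ⁻¹)   ≈⟨ *-cong (⁻¹-inverse x (*-≉0ˡ xy≉0)) (⁻¹-inverse y (*-≉0ʳ xy≉0)) ⟩
    1# * 1#                   ≈⟨ *-identityʳ 1# ⟩
    1#                        ∎)

  1*1⁻¹ : (1# * 1#) ⁻¹ ≈ 1#
  1*1⁻¹ = ⁻¹-unique (*-≉0 1≉0 1≉0) (trans (*-identityʳ (1# * 1#)) (*-identityʳ 1#))

  /-*-cancel : ∀ {x y f} → y * f ≉0 → x / (y * f) * f ≈ x / y
  /-*-cancel {x} {y} {f} yf≉0 = begin
    x * (y * f) ⁻¹ * f           ≈⟨ *-congʳ (*-congˡ (⁻¹-* yf≉0)) ⟩
    x * (y ⁻¹ * f ⁻¹) * f        ≈⟨ solve 4 (λ x y' f f' → x ⊗ (y' ⊗ f') ⊗ f ⊜ x ⊗ y' ⊗ (f ⊗ f')) refl x (y ⁻¹) f (f ⁻¹) ⟩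
    x * y ⁻¹ * (f * f ⁻¹)        ≈⟨ trans (*-congˡ (⁻¹-inverse f (*-≉0ʳ yf≉0))) (*-identityʳ _) ⟩
    x * y ⁻¹                     ∎

  quotient-step : ∀ {x y x' y' f g} → y' ≉0 → x' ≈ x * g → y' ≈ y * f → x' / y' * f ≈ x / y * g
  quotient-step {x} {y} {x'} {y'} {f} {g} y'≉0 x'≈xg y'≈yf = begin
    x' * y' ⁻¹ * f         ≈⟨ *-congʳ (*-cong x'≈xg (⁻¹-cong y'≈yf y'≉0)) ⟩
    (x * g) / (y * f) * f  ≈⟨ /-*-cancel (≉0-resp y'≈yf y'≉0) ⟩
    (x * g) * y ⁻¹         ≈⟨ solve 3 (λ x g y' → (x ⊗ g) ⊗ y' ⊜ x ⊗ y' ⊗ g) refl x g (y ⁻¹) ⟩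
    x / y * g              ∎

  unit-absorb : ∀ {u v} t → u * v ≈ 1# → u * (1# + v * t) ≈ u + t
  unit-absorb {u} {v} t uv≈1 = begin
    u * (1# + v * t)     ≈⟨ solve 3 (λ u v t → u ⊗ (𝟙 ⊕ v ⊗ t) ⊜ u ⊕ (u ⊗ v) ⊗ t) refl u v t ⟩
    u + (u * v) * t      ≈⟨ +-congˡ (trans (*-congʳ uv≈1) (*-identityˡ t)) ⟩
    u + t                ∎

  move-to-right : ∀ {x y z} → x + y ≈ z → x ≈ z - y
  move-to-right {x} {y} {z} x+y≈z = begin
    x              ≈⟨ solve 2 (λ x y → x ⊜ (x ⊕ y) ⊖ y) refl x y ⟩
    (x + y) - y    ≈⟨ +-congʳ x+y≈z ⟩
    z - y          ∎

  ≈-from-difference : ∀ {x y} → x - y ≈ 0# → x ≈ y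
  ≈-from-difference {x} {y} x-y≈0 = begin
    x              ≈⟨ solve 2 (λ x y → x ⊜ (x ⊖ y) ⊕ y) refl x y ⟩
    (x - y) + y    ≈⟨ trans (+-congʳ x-y≈0) (+-identityˡ y) ⟩
    y              ∎

  transfer : ∀ {g h L L′ R R′} → g ≉0 → g * L′ ≈ h * L → g * R′ ≈ h * R → L ≈ R → L′ ≈ R′
  transfer {g} {h} {L} {L′} {R} {R′} g≉0 gL′≈hL gR′≈hR L≈R = *-cancelʳ g≉0 (begin
    L′ * g   ≈⟨ *-comm L′ g ⟩
    g * L′   ≈⟨ gL′≈hL ⟩
    h * L    ≈⟨ *-congˡ L≈R ⟩
    h * R    ≈⟨ sym gR′≈hR ⟩
    g * R′   ≈⟨ *-comm g R′ ⟩
    R′ * g   ∎)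

  ^-≡ : ∀ x {m n} → m ≡ n → x ^ m ≈ x ^ n
  ^-≡ x m≡n = reflexive (≡.cong (x ^_) m≡n)

  ^-+ : ∀ x m n → x ^ (m +ℕ n) ≈ x ^ m * x ^ n
  ^-+ x zero n = sym (*-identityˡ _)
  ^-+ x (suc m) n = trans (*-congˡ (^-+ x m n)) (sym (*-assoc _ _ _))

  ^-⁻¹ : ∀ {x} n → x ≉0 → x ^ n * (x ⁻¹) ^ n ≈ 1#
  ^-⁻¹ zero x≉0 = *-identityʳ 1#
  ^-⁻¹ {x} (suc n) x≉0 = begin
    (x * x ^ n) * (x ⁻¹ * (x ⁻¹) ^ n)     ≈⟨ solve 4 (λ x y x' y' → (x ⊗ y) ⊗ (x' ⊗ y') ⊜ (x ⊗ x') ⊗ (y ⊗ y')) refl x (x ^ n) (x ⁻¹) ((x ⁻¹) ^ n) ⟩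
    (x * x ⁻¹) * (x ^ n * (x ⁻¹) ^ n)     ≈⟨ *-cong (⁻¹-inverse x x≉0) (^-⁻¹ n x≉0) ⟩
    1# * 1#                               ≈⟨ *-identityʳ 1# ⟩
    1#                                    ∎


module Sums {ℓc ℓe : Level} (F : Field ℓc ℓe) where
  open Field F
  open FieldOps F
  open FieldLemmas F
  open import Relation.Binary.Reasoning.Setoid setoid

  sumTo-linear : ∀ n u v (f g : ℕ → Carrier) →
    sumTo n (λ k → u * f k - v * g k) ≈ u * sumTo n f - v * sumTo n g
  sumTo-linear zero u v f g = refl
  sumTo-linear (suc n) u v f g = begin
    sumTo n (λ k → u * f k - v * g k) + (u * f (suc n) - v * g (suc n))
      ≈⟨ +-congʳ (sumTo-linear n u v f g) ⟩
    (u * sumTo n f - v * sumTo n g) + (u * f (suc n) - v * g (suc n))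
      ≈⟨ solve 6 (λ u v F G f g → (u ⊗ F ⊖ v ⊗ G) ⊕ (u ⊗ f ⊖ v ⊗ g) ⊜ u ⊗ (F ⊕ f) ⊖ v ⊗ (G ⊕ g))
           refl u v (sumTo n f) (sumTo n g) (f (suc n)) (g (suc n)) ⟩
    u * (sumTo n f + f (suc n)) - v * (sumTo n g + g (suc n)) ∎

  -- telescoping, with a last summand that may differ from G (n + 1) - G n
  telescope : ∀ n (f G : ℕ → Carrier) Z →
    (∀ k → k < n → f k ≈ G (suc k) - G k) → f n ≈ Z - G n → sumTo n f ≈ Z - G 0
  telescope zero f G Z _ last = last
  telescope (suc n) f G Z step last = begin
    sumTo n f + f (suc n)              ≈⟨ +-cong (telescope n f G (G (suc n)) (λ k k<n → step k (ℕₚ.m<n⇒m<1+n k<n)) (step n ℕₚ.≤-refl)) last ⟩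
    (G (suc n) - G 0) + (Z - G (suc n)) ≈⟨ solve 3 (λ G₀ G₁ Z → (G₁ ⊖ G₀) ⊕ (Z ⊖ G₁) ⊜ Z ⊖ G₀) refl (G 0) (G (suc n)) Z ⟩
    Z - G 0                             ∎


module Pochhammer {ℓc ℓe : Level} (F : Field ℓc ℓe) where
  open Field F
  open FieldOps F
  open FieldLemmas F
  open import Relation.Binary.Reasoning.Setoid setoid

  poch-≉0-≤ : ∀ x q {m n} → m ≤ n → poch x q n ≉0 → poch x q m ≉0
  poch-≉0-≤ x q {n = zero} z≤n p≉0 = p≉0
  poch-≉0-≤ x q {m} {suc n} m≤1+n p≉0 with ℕₚ.m≤n⇒m<n∨m≡n m≤1+n
  ... | inj₁ m<1+n = poch-≉0-≤ x q (ℕₚ.≤-pred m<1+n) (*-≉0ˡ p≉0)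
  ... | inj₂ ≡.refl = p≉0

  poch-factor-≉0 : ∀ x q {j n} → j < n → poch x q n ≉0 → 1# - x * q ^ j ≉0
  poch-factor-≉0 x q j<n p≉0 = *-≉0ʳ (poch-≉0-≤ x q j<n p≉0)

  poch-front : ∀ {x y} q k → x * q ≈ y → poch x q (suc k) ≈ (1# - x) * poch y q k
  poch-front {x} {y} q zero xq≈y = solve 1 (λ x → 𝟙 ⊗ (𝟙 ⊖ x ⊗ 𝟙) ⊜ (𝟙 ⊖ x) ⊗ 𝟙) refl x
  poch-front {x} {y} q (suc k) xq≈y = begin
    poch x q (suc k) * (1# - x * (q * q ^ k))   ≈⟨ *-cong (poch-front q k xq≈y) (+-congˡ (-‿cong (sym (*-assoc x q (q ^ k))))) ⟩
    (1# - x) * poch y q k * (1# - x * q * q ^ k) ≈⟨ *-congˡ (+-congˡ (-‿cong (*-congʳ xq≈y))) ⟩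
    (1# - x) * poch y q k * (1# - y * q ^ k)     ≈⟨ *-assoc _ _ _ ⟩
    (1# - x) * poch y q (suc k)                  ∎

  module QBinomial (q : Carrier) where

    fac : ℕ → Carrier
    fac n = poch q q n

    FactorialsNonzero : ℕ → Set ℓe
    FactorialsNonzero M = ∀ n → n ≤ M → fac n ≉0

    factorials-≤ : ∀ {M M′} → M′ ≤ M → FactorialsNonzero M → FactorialsNonzero M′
    factorials-≤ M′≤M fac≉0 n n≤M′ = fac≉0 n (ℕₚ.≤-trans n≤M′ M′≤M)

    qbinom-split : ∀ n j m → n ≡ j +ℕ m → qbinom q n j ≈ fac n / (fac j * fac m)
    qbinom-split n j m n≡j+m = reflexive (≡.cong (λ t → fac n / (fac j * fac t))
      (≡.trans (≡.cong (_∸ j) n≡j+m) (ℕₚ.m+n∸m≡n j m)))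

    qbinom-symmetric : ∀ j m → fac j * fac m ≉0 → qbinom q (j +ℕ m) j ≈ qbinom q (m +ℕ j) m
    qbinom-symmetric j m nz = begin
      qbinom q (j +ℕ m) j            ≈⟨ qbinom-split (j +ℕ m) j m ≡.refl ⟩
      fac (j +ℕ m) / (fac j * fac m) ≈⟨ *-cong (reflexive (≡.cong fac (ℕₚ.+-comm j m))) (⁻¹-cong (*-comm _ _) nz) ⟩
      fac (m +ℕ j) / (fac m * fac j) ≈⟨ sym (qbinom-split (m +ℕ j) m j ≡.refl) ⟩
      qbinom q (m +ℕ j) m            ∎

    qbinom-raise-both : ∀ j m → FactorialsNonzero (suc (j +ℕ m)) →
      qbinom q (suc (j +ℕ m)) (suc j) * (1# - q ^ suc j) ≈ qbinom q (j +ℕ m) j * (1# - q ^ suc (j +ℕ m))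
    qbinom-raise-both j m nz = begin
      qbinom q (suc (j +ℕ m)) (suc j) * (1# - q ^ suc j)
        ≈⟨ *-congʳ (qbinom-split (suc (j +ℕ m)) (suc j) m ≡.refl) ⟩
      fac (suc (j +ℕ m)) / (fac (suc j) * fac m) * (1# - q ^ suc j)
        ≈⟨ quotient-step denominator≉0 refl (solve 3 (λ a b g → (a ⊗ g) ⊗ b ⊜ (a ⊗ b) ⊗ g) refl (fac j) (fac m) _) ⟩
      fac (j +ℕ m) / (fac j * fac m) * (1# - q ^ suc (j +ℕ m))
        ≈⟨ *-congʳ (sym (qbinom-split (j +ℕ m) j m ≡.refl)) ⟩
      qbinom q (j +ℕ m) j * (1# - q ^ suc (j +ℕ m)) ∎
      where
      denominator≉0 : fac (suc j) * fac m ≉0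
      denominator≉0 = *-≉0 (nz (suc j) (s≤s (ℕₚ.m≤m+n j m))) (nz m (ℕₚ.m≤n⇒m≤1+n (ℕₚ.m≤n+m m j)))

    qbinom-raise-top : ∀ j m → FactorialsNonzero (suc (j +ℕ m)) →
      qbinom q (suc (j +ℕ m)) j * (1# - q ^ suc m) ≈ qbinom q (j +ℕ m) j * (1# - q ^ suc (j +ℕ m))
    qbinom-raise-top j m nz = begin
      qbinom q (suc (j +ℕ m)) j * (1# - q ^ suc m)
        ≈⟨ *-congʳ (qbinom-split (suc (j +ℕ m)) j (suc m) (≡.sym (ℕₚ.+-suc j m))) ⟩
      fac (suc (j +ℕ m)) / (fac j * fac (suc m)) * (1# - q ^ suc m)
        ≈⟨ quotient-step denominator≉0 refl (sym (*-assoc _ _ _)) ⟩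
      fac (j +ℕ m) / (fac j * fac m) * (1# - q ^ suc (j +ℕ m))
        ≈⟨ *-congʳ (sym (qbinom-split (j +ℕ m) j m ≡.refl)) ⟩
      qbinom q (j +ℕ m) j * (1# - q ^ suc (j +ℕ m)) ∎
      where
      denominator≉0 : fac j * fac (suc m) ≉0
      denominator≉0 = *-≉0 (nz j (ℕₚ.m≤n⇒m≤1+n (ℕₚ.m≤m+n j m))) (nz (suc m) (s≤s (ℕₚ.m≤n+m m j)))

    qbinom-lower : ∀ i m → FactorialsNonzero (suc (i +ℕ m)) →
      qbinom q (suc (i +ℕ m)) i * (1# - q ^ suc m) ≈ qbinom q (suc (i +ℕ m)) (suc i) * (1# - q ^ suc i)
    qbinom-lower i m nz = begin
      qbinom q n i * (1# - q ^ suc m)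
        ≈⟨ *-congʳ (qbinom-split n i (suc m) (≡.sym (ℕₚ.+-suc i m))) ⟩
      fac n / (fac i * fac (suc m)) * (1# - q ^ suc m)
        ≈⟨ quotient-step (*-≉0 (nz i i≤n) (nz (suc m) m+1≤n)) (sym (*-identityʳ _)) (sym (*-assoc _ _ _)) ⟩
      fac n / (fac i * fac m) * 1#
        ≈⟨ sym (quotient-step (*-≉0 (nz (suc i) (s≤s (ℕₚ.m≤m+n i m))) (nz m m≤n)) (sym (*-identityʳ _))
                  (solve 3 (λ a b g → (a ⊗ g) ⊗ b ⊜ (a ⊗ b) ⊗ g) refl (fac i) (fac m) _)) ⟩
      fac n / (fac (suc i) * fac m) * (1# - q ^ suc i)
        ≈⟨ *-congʳ (sym (qbinom-split n (suc i) m ≡.refl)) ⟩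
      qbinom q n (suc i) * (1# - q ^ suc i) ∎
      where
      n = suc (i +ℕ m)
      i≤n : i ≤ n
      i≤n = ℕₚ.m≤n⇒m≤1+n (ℕₚ.m≤m+n i m)
      m≤n : m ≤ n
      m≤n = ℕₚ.m≤n⇒m≤1+n (ℕₚ.m≤n+m m i)
      m+1≤n : suc m ≤ n
      m+1≤n = s≤s (ℕₚ.m≤n+m m i)

split-at : ∀ {N r s k} → N ≡ r +ℕ s → k ≤ r → N ≡ k +ℕ ((r ∸ k) +ℕ s)
split-at {s = s} {k} N≡r+s k≤r =
  ≡.trans N≡r+s (≡.trans (≡.cong (_+ℕ s) (≡.sym (ℕₚ.m+[n∸m]≡n k≤r))) (ℕₚ.+-assoc k _ s))

∸-of-split : ∀ {N} k {M} → N ≡ k +ℕ M → N ∸ k ≡ M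
∸-of-split k {M} N≡k+M = ≡.trans (≡.cong (_∸ k) N≡k+M) (ℕₚ.m+n∸m≡n k M)

-- The corollary, for fixed q ≠ 0 and c.  All statements are made for arbitrary
-- a and b, so that they can also be used with a and b exchanged.
module Corollary {ℓc ℓe : Level} (F : Field ℓc ℓe) (q c : Field.Carrier F) (q≉0 : ¬ (Field._≈_ F q (Field.0# F))) where
  open Field F
  open FieldOps F
  open FieldLemmas F
  open Sums F
  open Pochhammer F
  open QBinomial q
  open import Relation.Binary.Reasoning.Setoid setoid

  α : Carrier → Carrier → ℕ → Carrier
  α a b s = a * ((q ⁻¹) ^ s) / b

  den : Carrier → Carrier → ℕ → Carrier
  den a b k = poch (- (a * q)) q k * poch (- (c * q / b)) q k

  ratio : Carrier → Carrier → ℕ → ℕ → Carrier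
  ratio a b s k = (poch c q k * poch (α a b s) q k) / den a b k

  -- the summands and the sum of the first sum of the corollary (there N = r + s);
  -- the second sum is sum b a N s r
  term : Carrier → Carrier → ℕ → ℕ → ℕ → ℕ → Carrier
  term a b N r s k = qbinom q (N ∸ k) (r ∸ k) * ratio a b s k * q ^ ((s +ℕ 1) *ℕ k)

  sum : Carrier → Carrier → ℕ → ℕ → ℕ → Carrier
  sum a b N r s = sumTo r (term a b N r s)

  lhs : Carrier → Carrier → ℕ → ℕ → ℕ → Carrier
  lhs a b N r s = (1# + b) / (c + b) * sum a b N r s - (1# + a) / (c + a) * sum b a N s r

  rhs-numerator rhs-denominator : Carrier → Carrier → ℕ → ℕ → Carrier
  rhs-numerator a b r s = poch (a * q / b) q r * poch (b * q / a) q s * poch c q (1 +ℕ r +ℕ s)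
  rhs-denominator a b r s =
    poch (- (a * q)) q r * poch (- (b * q)) q s * poch (- (c / b)) q (r +ℕ 1) * poch (- (c / a)) q (s +ℕ 1)

  rhs : Carrier → Carrier → ℕ → ℕ → Carrier
  rhs a b r s = ((1# / b) - (1# / a)) * (rhs-numerator a b r s / rhs-denominator a b r s)

  growAt : Carrier → Carrier → Carrier → Carrier
  growAt a b y = (1# + a * y) * (1# + c / b * y)

  shrinkAt : Carrier → Carrier → Carrier → Carrier → Carrier
  shrinkAt a b y Y = (1# - a / b * y) * (1# - c * Y)

  grow : Carrier → Carrier → ℕ → Carrier
  grow a b n = growAt a b (q ^ n)

  shrink : Carrier → Carrier → ℕ → ℕ → Carrier
  shrink a b n N = shrinkAt a b (q ^ n) (q ^ N)

  growAt-cong : ∀ a b {y y'} → y ≈ y' → growAt a b y ≈ growAt a b y'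
  growAt-cong a b y≈y' = *-cong (+-congˡ (*-congˡ y≈y')) (+-congˡ (*-congˡ y≈y'))

  shrinkAt-cong : ∀ a b {y y' Y Y'} → y ≈ y' → Y ≈ Y' → shrinkAt a b y Y ≈ shrinkAt a b y' Y'
  shrinkAt-cong a b y≈y' Y≈Y' = *-cong (+-congˡ (-‿cong (*-congˡ y≈y'))) (+-congˡ (-‿cong (*-congˡ Y≈Y')))

  core : Carrier → Carrier → ℕ → ℕ → ℕ → ℕ → Carrier
  core a b M i s k = qbinom q M i * ratio a b s k * q ^ (s *ℕ k)

  summand : Carrier → Carrier → ℕ → ℕ → ℕ → ℕ → Carrier
  summand a b M i s k = qbinom q M i * ratio a b s k * q ^ (suc s *ℕ k)

  -- the value of the boundary terms of the telescoping sums
  edge : Carrier → Carrier → ℕ → ℕ → Carrier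
  edge a b M i = qbinom q M i * grow a b 0

  record Admissible (a b : Carrier) (r s : ℕ) : Set ℓe where
    field
      a≉0 : a ≉0
      b≉0 : b ≉0
      c+a≉0 : c + a ≉0
      c+b≉0 : c + b ≉0
      factorials : FactorialsNonzero (r +ℕ s)
      den₁ : ∀ k → k ≤ r → den a b k ≉0
      den₂ : ∀ k → k ≤ s → den b a k ≉0
      tail₁ : poch (- (c / b)) q (r +ℕ 1) ≉0
      tail₂ : poch (- (c / a)) q (s +ℕ 1) ≉0

  swap : ∀ {a b r s} → Admissible a b r s → Admissible b a s r
  swap {r = r} {s} adm = record
    { a≉0 = b≉0 ; b≉0 = a≉0 ; c+a≉0 = c+b≉0 ; c+b≉0 = c+a≉0
    ; factorials = factorials-≤ (ℕₚ.≤-reflexive (ℕₚ.+-comm s r)) factorials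
    ; den₁ = den₂ ; den₂ = den₁ ; tail₁ = tail₂ ; tail₂ = tail₁ }
    where open Admissible adm

  lower : ∀ {a b r s} → Admissible a b (suc r) s → Admissible a b r s
  lower adm = record
    { a≉0 = a≉0 ; b≉0 = b≉0 ; c+a≉0 = c+a≉0 ; c+b≉0 = c+b≉0
    ; factorials = factorials-≤ (ℕₚ.n≤1+n _) factorials
    ; den₁ = λ k k≤r → den₁ k (ℕₚ.m≤n⇒m≤1+n k≤r) ; den₂ = den₂
    ; tail₁ = *-≉0ˡ tail₁ ; tail₂ = tail₂ }
    where open Admissible adm

  rhs-denominator-≉0 : ∀ {a b r s} → Admissible a b r s → rhs-denominator a b r s ≉0
  rhs-denominator-≉0 {r = r} {s} adm =
    *-≉0 (*-≉0 (*-≉0 (*-≉0ˡ (den₁ r ℕₚ.≤-refl)) (*-≉0ˡ (den₂ s ℕₚ.≤-refl))) tail₁) tail₂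
    where open Admissible adm

  qbinom-≡ : ∀ {M M' i i'} → M ≡ M' → i ≡ i' → qbinom q M i ≈ qbinom q M' i'
  qbinom-≡ M≡M' i≡i' = reflexive (≡.cong₂ (qbinom q) M≡M' i≡i')

  ^-split : ∀ {n} m₁ m₂ → n ≡ m₁ +ℕ m₂ → q ^ n ≈ q ^ m₁ * q ^ m₂
  ^-split m₁ m₂ n≡m₁+m₂ = trans (^-≡ q n≡m₁+m₂) (^-+ q m₁ m₂)

  core-≡ : ∀ a b s k {M M' i i'} → M ≡ M' → i ≡ i' → core a b M i s k ≈ core a b M' i' s k
  core-≡ a b s k M≡M' i≡i' = *-congʳ (*-congʳ (qbinom-≡ M≡M' i≡i'))

  term-split : ∀ a b N r s k → term a b N r s k ≈ core a b (N ∸ k) (r ∸ k) s k * q ^ k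
  term-split a b N r s k = begin
    B * ρ * q ^ ((s +ℕ 1) *ℕ k)          ≈⟨ *-congˡ (^-split (s *ℕ k) k (≡.trans (ℕₚ.*-distribʳ-+ k s 1) (≡.cong (s *ℕ k +ℕ_) (ℕₚ.*-identityˡ k)))) ⟩
    B * ρ * (q ^ (s *ℕ k) * q ^ k)       ≈⟨ sym (*-assoc _ _ _) ⟩
    B * ρ * q ^ (s *ℕ k) * q ^ k         ∎
    where
    B = qbinom q (N ∸ k) (r ∸ k)
    ρ = ratio a b s k

  term-at : ∀ a b N r s k {M i} → N ∸ k ≡ M → r ∸ k ≡ i → term a b N r s k ≈ summand a b M i s k
  term-at a b N r s k N∸k≡M r∸k≡i =
    *-cong (*-congʳ (qbinom-≡ N∸k≡M r∸k≡i)) (^-≡ q (≡.cong (_*ℕ k) (ℕₚ.+-comm s 1)))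

  ratio-zero : ∀ a b s → ratio a b s 0 ≈ 1#
  ratio-zero a b s = trans (*-cong (*-identityʳ 1#) 1*1⁻¹) (*-identityʳ 1#)

  core-zero : ∀ a b M i s → core a b M i s 0 ≈ qbinom q M i
  core-zero a b M i s = begin
    qbinom q M i * ratio a b s 0 * q ^ (s *ℕ 0)   ≈⟨ *-cong (*-congˡ (ratio-zero a b s)) (^-≡ q (ℕₚ.*-zeroʳ s)) ⟩
    qbinom q M i * 1# * 1#                        ≈⟨ trans (*-identityʳ _) (*-identityʳ _) ⟩
    qbinom q M i                                  ∎

  term-origin : ∀ a b → term a b 0 0 0 0 ≈ 1#
  term-origin a b = begin
    term a b 0 0 0 0         ≈⟨ term-split a b 0 0 0 0 ⟩
    core a b 0 0 0 0 * 1#    ≈⟨ trans (*-identityʳ _) (core-zero a b 0 0 0) ⟩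
    1# * (1# * 1#) ⁻¹        ≈⟨ trans (*-identityˡ _) 1*1⁻¹ ⟩
    1#                       ∎

  α-scale : ∀ a b n → α a b n * q ^ n ≈ a / b
  α-scale a b n = begin
    a * (q ⁻¹) ^ n * b ⁻¹ * q ^ n     ≈⟨ solve 4 (λ a x' b' x → a ⊗ x' ⊗ b' ⊗ x ⊜ a ⊗ b' ⊗ (x ⊗ x')) refl a ((q ⁻¹) ^ n) (b ⁻¹) (q ^ n) ⟩
    a * b ⁻¹ * (q ^ n * (q ⁻¹) ^ n)   ≈⟨ trans (*-congˡ (^-⁻¹ n q≉0)) (*-identityʳ _) ⟩
    a * b ⁻¹                          ∎

  α-shift : ∀ a b s → α a b (suc s) * q ≈ α a b s
  α-shift a b s = begin
    a * (q ⁻¹ * (q ⁻¹) ^ s) * b ⁻¹ * q   ≈⟨ solve 5 (λ a q' x' b' q → a ⊗ (q' ⊗ x') ⊗ b' ⊗ q ⊜ a ⊗ x' ⊗ b' ⊗ (q ⊗ q')) refl a (q ⁻¹) ((q ⁻¹) ^ s) (b ⁻¹) q ⟩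
    a * (q ⁻¹) ^ s * b ⁻¹ * (q * q ⁻¹)   ≈⟨ trans (*-congˡ (⁻¹-inverse q q≉0)) (*-identityʳ _) ⟩
    a * (q ⁻¹) ^ s * b ⁻¹                ∎

  α-scale-factor : ∀ a b s k → (1# - α a b s * q ^ k) * q ^ s ≈ q ^ s - a / b * q ^ k
  α-scale-factor a b s k = begin
    (1# - α a b s * q ^ k) * q ^ s        ≈⟨ solve 3 (λ α x z → (𝟙 ⊖ α ⊗ x) ⊗ z ⊜ z ⊖ (α ⊗ z) ⊗ x) refl (α a b s) (q ^ k) (q ^ s) ⟩
    q ^ s - (α a b s * q ^ s) * q ^ k     ≈⟨ +-congˡ (-‿cong (*-congʳ (α-scale a b s))) ⟩
    q ^ s - a / b * q ^ k                 ∎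

  ratio-inverse : ∀ {a b} → a ≉0 → b ≉0 → b / a * (a / b) ≈ 1#
  ratio-inverse {a} {b} a≉0 b≉0 = begin
    b * a ⁻¹ * (a * b ⁻¹)       ≈⟨ solve 4 (λ a a' b b' → b ⊗ a' ⊗ (a ⊗ b') ⊜ (b ⊗ b') ⊗ (a ⊗ a')) refl a (a ⁻¹) b (b ⁻¹) ⟩
    (b * b ⁻¹) * (a * a ⁻¹)     ≈⟨ *-cong (⁻¹-inverse b b≉0) (⁻¹-inverse a a≉0) ⟩
    1# * 1#                     ≈⟨ *-identityʳ 1# ⟩
    1#                          ∎

  -- b q^{s+1}/a and α(s+1) = a q^{-s-1}/b are reciprocal, so
  -- (b/a) q^{s+1} (1 - α(s+1) t) = (b/a) q^{s+1} - t
  α-complement : ∀ {a b} s t → a ≉0 → b ≉0 → b / a * q ^ suc s * (1# - α a b (suc s) * t) ≈ b / a * q ^ suc s - t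
  α-complement {a} {b} s t a≉0 b≉0 = begin
    B * z * (1# - α a b (suc s) * t)         ≈⟨ solve 4 (λ B z α t → B ⊗ z ⊗ (𝟙 ⊖ α ⊗ t) ⊜ B ⊗ z ⊖ B ⊗ (α ⊗ z) ⊗ t) refl B z _ t ⟩
    B * z - B * (α a b (suc s) * z) * t      ≈⟨ +-congˡ (-‿cong (*-congʳ (*-congˡ (α-scale a b (suc s))))) ⟩
    B * z - B * (a / b) * t                  ≈⟨ +-congˡ (-‿cong (trans (*-congʳ (ratio-inverse a≉0 b≉0)) (*-identityˡ t))) ⟩
    B * z - t                                ∎
    where
    B = b / a
    z = q ^ suc s

  α-complement₁ : ∀ {a b} s → a ≉0 → b ≉0 → b / a * q ^ suc s * (1# - α a b (suc s)) ≈ b / a * q ^ suc s - 1#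
  α-complement₁ s a≉0 b≉0 = trans (*-congˡ (+-congˡ (-‿cong (sym (*-identityʳ _))))) (α-complement s 1# a≉0 b≉0)

  -- the last factors of the two denominator symbols make up grow a b (k + 1)
  den-step : ∀ a b k → den a b (suc k) ≈ den a b k * grow a b (suc k)
  den-step a b k = solve 7
    (λ A C a q c b' x → (A ⊗ (𝟙 ⊖ ⊝ (a ⊗ q) ⊗ x)) ⊗ (C ⊗ (𝟙 ⊖ ⊝ (c ⊗ q ⊗ b') ⊗ x))
                      ⊜ (A ⊗ C) ⊗ ((𝟙 ⊕ a ⊗ (q ⊗ x)) ⊗ (𝟙 ⊕ c ⊗ b' ⊗ (q ⊗ x))))
    refl (poch (- (a * q)) q k) (poch (- (c * q / b)) q k) a q c (b ⁻¹) (q ^ k)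

  grow-≉0 : ∀ a b r → den a b (suc r) ≉0 → grow a b (suc r) ≉0
  grow-≉0 a b r den≉0 = *-≉0ʳ (≉0-resp (den-step a b r) den≉0)

  ratio-step : ∀ a b s k → den a b (suc k) ≉0 →
    ratio a b s (suc k) * grow a b (suc k) ≈ ratio a b s k * ((1# - c * q ^ k) * (1# - α a b s * q ^ k))
  ratio-step a b s k den≉0 = quotient-step den≉0
    (solve 4 (λ C A g h → (C ⊗ g) ⊗ (A ⊗ h) ⊜ (C ⊗ A) ⊗ (g ⊗ h)) refl (poch c q k) (poch (α a b s) q k) _ _)
    (den-step a b k)

  -- the same, with the parameter moving from α(s+1) to α(s) = α(s+1) q
  ratio-front : ∀ a b s k → den a b (suc k) ≉0 →
    ratio a b (suc s) (suc k) * grow a b (suc k) ≈ ratio a b s k * ((1# - c * q ^ k) * (1# - α a b (suc s)))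
  ratio-front a b s k den≉0 = quotient-step den≉0 numerator-step (den-step a b k)
    where
    numerator-step : poch c q (suc k) * poch (α a b (suc s)) q (suc k)
                     ≈ (poch c q k * poch (α a b s) q k) * ((1# - c * q ^ k) * (1# - α a b (suc s)))
    numerator-step = begin
      poch c q k * (1# - c * q ^ k) * poch (α a b (suc s)) q (suc k)
        ≈⟨ *-congˡ (poch-front q k (α-shift a b s)) ⟩
      poch c q k * (1# - c * q ^ k) * ((1# - α a b (suc s)) * poch (α a b s) q k)
        ≈⟨ solve 4 (λ C g h A → C ⊗ g ⊗ (h ⊗ A) ⊜ (C ⊗ A) ⊗ (g ⊗ h)) refl _ _ _ _ ⟩
      (poch c q k * poch (α a b s) q k) * ((1# - c * q ^ k) * (1# - α a b (suc s))) ∎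

  -- the factor 1 - α(s+1) q^k completes (α(s+1); q)_k to (1 - α(s+1)) (α(s); q)_k
  ratio-absorb : ∀ a b s k →
    ratio a b (suc s) k * (1# - α a b (suc s) * q ^ k) ≈ (1# - α a b (suc s)) * ratio a b s k
  ratio-absorb a b s k = begin
    (C * A₁) * D ⁻¹ * g                        ≈⟨ solve 4 (λ C A₁ D' g → (C ⊗ A₁) ⊗ D' ⊗ g ⊜ C ⊗ (A₁ ⊗ g) ⊗ D') refl C A₁ (D ⁻¹) g ⟩
    C * poch (α a b (suc s)) q (suc k) * D ⁻¹  ≈⟨ *-congʳ (*-congˡ (poch-front q k (α-shift a b s))) ⟩
    C * ((1# - α a b (suc s)) * A₀) * D ⁻¹     ≈⟨ solve 4 (λ C h A₀ D' → C ⊗ (h ⊗ A₀) ⊗ D' ⊜ h ⊗ ((C ⊗ A₀) ⊗ D')) refl C _ A₀ (D ⁻¹) ⟩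
    (1# - α a b (suc s)) * ((C * A₀) * D ⁻¹)   ∎
    where
    C = poch c q k
    A₀ = poch (α a b s) q k
    A₁ = poch (α a b (suc s)) q k
    D = den a b k
    g = 1# - α a b (suc s) * q ^ k

  -- With y = q^{r+1}, the sums satisfy
  --   grow(r+1) S(N+1, r+1, s) - shrink(r+1, N+1) S(N, r, s) = y [N+1, r+1] grow(0),
  -- by telescoping with the certificate (x = q^k)
  --   certificate-r(k) = - y [N+1-k, r+1-k] ratio(k) q^{sk} grow(k).
  certificate-r : Carrier → Carrier → ℕ → ℕ → ℕ → ℕ → Carrier
  certificate-r a b N r s k = - (q ^ suc r * (core a b (suc N ∸ k) (suc r ∸ k) s k * grow a b k))

  -- the polynomial identity behind one telescoping step, after division by the
  -- common factor W (x = q^k, p = q^{r-k+1}, z = q^s)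
  identity-r : ∀ a b x p z W →
    growAt a b (x * p) * ((1# - p * z) * W * x) - shrinkAt a b (x * p) (x * (p * z)) * (W * x * (1# - p))
    ≈ - (x * p * (W * ((1# - c * x) * (z - a / b * x)))) * (1# - p) - - (x * p * ((1# - p * z) * W * growAt a b x))
  identity-r a b x p z W = solve 7
    (λ a b' c x p z W →
       ((𝟙 ⊕ a ⊗ (x ⊗ p)) ⊗ (𝟙 ⊕ c ⊗ b' ⊗ (x ⊗ p))) ⊗ ((𝟙 ⊖ p ⊗ z) ⊗ W ⊗ x)
         ⊖ ((𝟙 ⊖ a ⊗ b' ⊗ (x ⊗ p)) ⊗ (𝟙 ⊖ c ⊗ (x ⊗ (p ⊗ z)))) ⊗ (W ⊗ x ⊗ (𝟙 ⊖ p))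
       ⊜ (⊝ (x ⊗ p ⊗ (W ⊗ ((𝟙 ⊖ c ⊗ x) ⊗ (z ⊖ a ⊗ b' ⊗ x))))) ⊗ (𝟙 ⊖ p)
         ⊖ (⊝ (x ⊗ p ⊗ ((𝟙 ⊖ p ⊗ z) ⊗ W ⊗ ((𝟙 ⊕ a ⊗ x) ⊗ (𝟙 ⊕ c ⊗ b' ⊗ x))))))
    refl a (b ⁻¹) c x p z W

  core-raise-r : ∀ a b j s k → FactorialsNonzero (suc (j +ℕ s)) →
    core a b (suc (j +ℕ s)) (suc j) s k * (1# - q ^ suc j) ≈ (1# - q ^ suc j * q ^ s) * core a b (j +ℕ s) j s k
  core-raise-r a b j s k fac≉0 = begin
    B₁ * ρ * P * v                                  ≈⟨ solve 4 (λ B ρ P v → B ⊗ ρ ⊗ P ⊗ v ⊜ (B ⊗ v) ⊗ (ρ ⊗ P)) refl B₁ ρ P v ⟩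
    (B₁ * v) * (ρ * P)                              ≈⟨ *-congʳ (qbinom-raise-both j s fac≉0) ⟩
    (B₀ * (1# - q ^ suc (j +ℕ s))) * (ρ * P)        ≈⟨ *-congʳ (*-congˡ (+-congˡ (-‿cong (^-+ q (suc j) s)))) ⟩
    (B₀ * (1# - q ^ suc j * q ^ s)) * (ρ * P)       ≈⟨ solve 4 (λ B u ρ P → (B ⊗ u) ⊗ (ρ ⊗ P) ⊜ u ⊗ (B ⊗ ρ ⊗ P)) refl B₀ _ ρ P ⟩
    (1# - q ^ suc j * q ^ s) * (B₀ * ρ * P)         ∎
    where
    B₀ = qbinom q (j +ℕ s) j
    B₁ = qbinom q (suc (j +ℕ s)) (suc j)
    ρ = ratio a b s k
    P = q ^ (s *ℕ k)
    v = 1# - q ^ suc j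

  core-step : ∀ a b M i s k → den a b (suc k) ≉0 →
    core a b M i s (suc k) * grow a b (suc k) ≈ core a b M i s k * ((1# - c * q ^ k) * (q ^ s - a / b * q ^ k))
  core-step a b M i s k den≉0 = begin
    B * ratio a b s (suc k) * q ^ (s *ℕ suc k) * grow a b (suc k)
      ≈⟨ solve 4 (λ B ρ P g → B ⊗ ρ ⊗ P ⊗ g ⊜ B ⊗ (ρ ⊗ g) ⊗ P) refl B _ _ _ ⟩
    B * (ratio a b s (suc k) * grow a b (suc k)) * q ^ (s *ℕ suc k)
      ≈⟨ *-cong (*-congˡ (ratio-step a b s k den≉0)) (^-split s (s *ℕ k) (ℕₚ.*-suc s k)) ⟩
    B * (ratio a b s k * ((1# - c * q ^ k) * (1# - α a b s * q ^ k))) * (q ^ s * q ^ (s *ℕ k))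
      ≈⟨ solve 6 (λ B ρ g h z P → B ⊗ (ρ ⊗ (g ⊗ h)) ⊗ (z ⊗ P) ⊜ B ⊗ ρ ⊗ P ⊗ (g ⊗ (h ⊗ z))) refl B _ _ _ _ _ ⟩
    core a b M i s k * ((1# - c * q ^ k) * ((1# - α a b s * q ^ k) * q ^ s))
      ≈⟨ *-congˡ (*-congˡ (α-scale-factor a b s k)) ⟩
    core a b M i s k * ((1# - c * q ^ k) * (q ^ s - a / b * q ^ k)) ∎
    where B = qbinom q M i

  -- one telescoping step, verified after multiplication by 1 - q^{r-k+1}
  step-r-term : ∀ a b N r s k → N ≡ r +ℕ s → k ≤ r → FactorialsNonzero (suc N) → den a b (suc k) ≉0 →
    grow a b (suc r) * term a b (suc N) (suc r) s k - shrink a b (suc r) (suc N) * term a b N r s k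
    ≈ certificate-r a b N r s (suc k) - certificate-r a b N r s k
  step-r-term a b N r s k N≡r+s k≤r fac≉0 den≉0 = *-cancelʳ v≉0 (begin
    (E * t₁ - ρ * t₀) * v
      ≈⟨ solve 5 (λ E ρ t₁ t₀ v → (E ⊗ t₁ ⊖ ρ ⊗ t₀) ⊗ v ⊜ E ⊗ (t₁ ⊗ v) ⊖ ρ ⊗ (t₀ ⊗ v)) refl E ρ t₁ t₀ v ⟩
    E * (t₁ * v) - ρ * (t₀ * v)
      ≈⟨ +-cong (*-cong E≈ t₁v≈) (-‿cong (*-cong ρ≈ (*-congʳ t₀≈))) ⟩
    growAt a b (x * p) * ((1# - p * z) * W * x) - shrinkAt a b (x * p) (x * (p * z)) * (W * x * v)
      ≈⟨ identity-r a b x p z W ⟩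
    - (x * p * (W * ((1# - c * x) * (z - a / b * x)))) * v - - (x * p * ((1# - p * z) * W * growAt a b x))
      ≈⟨ +-cong (*-congʳ (sym G₁≈)) (-‿cong (sym G₀v≈)) ⟩
    G₁ * v - G₀ * v
      ≈⟨ solve 3 (λ G₁ G₀ v → G₁ ⊗ v ⊖ G₀ ⊗ v ⊜ (G₁ ⊖ G₀) ⊗ v) refl G₁ G₀ v ⟩
    (G₁ - G₀) * v ∎)
    where
    j = r ∸ k
    x = q ^ k
    p = q ^ suc j
    z = q ^ s
    v = 1# - p
    E = grow a b (suc r)
    ρ = shrink a b (suc r) (suc N)
    t₁ = term a b (suc N) (suc r) s k
    t₀ = term a b N r s k
    G₁ = certificate-r a b N r s (suc k)
    G₀ = certificate-r a b N r s k
    C₁ = core a b (suc N ∸ k) (suc r ∸ k) s k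
    W = core a b (j +ℕ s) j s k

    N≡ : N ≡ k +ℕ (j +ℕ s)
    N≡ = split-at N≡r+s k≤r
    1+N≡ : suc N ≡ k +ℕ suc (j +ℕ s)
    1+N≡ = ≡.trans (≡.cong suc N≡) (≡.sym (ℕₚ.+-suc k (j +ℕ s)))
    fac≉0′ : FactorialsNonzero (suc (j +ℕ s))
    fac≉0′ = factorials-≤ (ℕₚ.≤-trans (ℕₚ.m≤n+m _ k) (ℕₚ.≤-reflexive (≡.sym 1+N≡))) fac≉0
    v≉0 : v ≉0
    v≉0 = poch-factor-≉0 q q {j} ℕₚ.≤-refl (fac≉0′ (suc j) (s≤s (ℕₚ.m≤m+n j s)))

    y≈ : q ^ suc r ≈ x * p
    y≈ = ^-split k (suc j) (≡.trans (≡.cong suc (≡.sym (ℕₚ.m+[n∸m]≡n k≤r))) (≡.sym (ℕₚ.+-suc k j)))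
    E≈ : E ≈ growAt a b (x * p)
    E≈ = growAt-cong a b y≈
    ρ≈ : ρ ≈ shrinkAt a b (x * p) (x * (p * z))
    ρ≈ = shrinkAt-cong a b y≈ (trans (^-split k (suc j +ℕ s) 1+N≡) (*-congˡ (^-+ q (suc j) s)))
    t₀≈ : t₀ ≈ W * x
    t₀≈ = trans (term-split a b N r s k) (*-congʳ (core-≡ a b s k {i = j} (∸-of-split k N≡) ≡.refl))
    C₁v≈ : C₁ * v ≈ (1# - p * z) * W
    C₁v≈ = trans (*-congʳ (core-≡ a b s k (∸-of-split k 1+N≡) (ℕₚ.+-∸-assoc 1 k≤r))) (core-raise-r a b j s k fac≉0′)
    t₁v≈ : t₁ * v ≈ (1# - p * z) * W * x
    t₁v≈ = begin
      t₁ * v       ≈⟨ *-congʳ (term-split a b (suc N) (suc r) s k) ⟩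
      C₁ * x * v   ≈⟨ solve 3 (λ C x v → C ⊗ x ⊗ v ⊜ (C ⊗ v) ⊗ x) refl C₁ x v ⟩
      C₁ * v * x   ≈⟨ *-congʳ C₁v≈ ⟩
      (1# - p * z) * W * x ∎
    G₀v≈ : G₀ * v ≈ - (x * p * ((1# - p * z) * W * growAt a b x))
    G₀v≈ = begin
      - (q ^ suc r * (C₁ * grow a b k)) * v    ≈⟨ solve 4 (λ y C g v → (⊝ (y ⊗ (C ⊗ g))) ⊗ v ⊜ ⊝ (y ⊗ ((C ⊗ v) ⊗ g))) refl _ C₁ _ v ⟩
      - (q ^ suc r * ((C₁ * v) * grow a b k))  ≈⟨ -‿cong (*-cong y≈ (*-congʳ C₁v≈)) ⟩
      - (x * p * ((1# - p * z) * W * growAt a b x)) ∎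
    G₁≈ : G₁ ≈ - (x * p * (W * ((1# - c * x) * (z - a / b * x))))
    G₁≈ = -‿cong (*-cong y≈ (trans (core-step a b (N ∸ k) j s k den≉0) (*-congʳ (core-≡ a b s k {i = j} (∸-of-split k N≡) ≡.refl))))

  step-r : ∀ a b N r s → N ≡ r +ℕ s → FactorialsNonzero (suc N) → (∀ k → k ≤ suc r → den a b k ≉0) →
    grow a b (suc r) * sum a b (suc N) (suc r) s - shrink a b (suc r) (suc N) * sum a b N r s
    ≈ q ^ suc r * edge a b (suc N) (suc r)
  step-r a b N r s N≡r+s fac≉0 den≉0 = begin
    E * (sumTo r t₁ + t₁ (suc r)) - ρ * sumTo r t₀
      ≈⟨ solve 5 (λ E ρ S₁ t S₀ → E ⊗ (S₁ ⊕ t) ⊖ ρ ⊗ S₀ ⊜ (E ⊗ S₁ ⊖ ρ ⊗ S₀) ⊕ E ⊗ t) refl E ρ (sumTo r t₁) (t₁ (suc r)) (sumTo r t₀) ⟩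
    (E * sumTo r t₁ - ρ * sumTo r t₀) + E * t₁ (suc r)
      ≈⟨ +-congʳ (sym (sumTo-linear r E ρ t₁ t₀)) ⟩
    sumTo r (λ k → E * t₁ k - ρ * t₀ k) + E * t₁ (suc r)
      ≈⟨ +-congʳ (telescope r _ G (G (suc r)) (λ k k<r → step k (ℕₚ.<⇒≤ k<r)) (step r ℕₚ.≤-refl)) ⟩
    (G (suc r) - G 0) + E * t₁ (suc r)
      ≈⟨ solve 3 (λ G₁ G₀ t → (G₁ ⊖ G₀) ⊕ t ⊜ (G₁ ⊕ t) ⊖ G₀) refl (G (suc r)) (G 0) _ ⟩
    (G (suc r) + E * t₁ (suc r)) - G 0
      ≈⟨ +-cong last-cancels (-‿cong (-‿cong (*-congˡ (*-congʳ (core-zero a b (suc N) (suc r) s))))) ⟩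
    0# - - (q ^ suc r * edge a b (suc N) (suc r))
      ≈⟨ solve 1 (λ X → 𝟘 ⊖ ⊝ X ⊜ X) refl _ ⟩
    q ^ suc r * edge a b (suc N) (suc r) ∎
    where
    E = grow a b (suc r)
    ρ = shrink a b (suc r) (suc N)
    t₁ = term a b (suc N) (suc r) s
    t₀ = term a b N r s
    G = certificate-r a b N r s
    step : ∀ k → k ≤ r → E * t₁ k - ρ * t₀ k ≈ G (suc k) - G k
    step k k≤r = step-r-term a b N r s k N≡r+s k≤r fac≉0 (den≉0 (suc k) (s≤s k≤r))
    last-cancels : G (suc r) + E * t₁ (suc r) ≈ 0#
    last-cancels = begin
      - (q ^ suc r * (C * E)) + E * t₁ (suc r)        ≈⟨ +-congˡ (*-congˡ (term-split a b (suc N) (suc r) s (suc r))) ⟩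
      - (q ^ suc r * (C * E)) + E * (C * q ^ suc r)   ≈⟨ solve 3 (λ y C E → ⊝ (y ⊗ (C ⊗ E)) ⊕ E ⊗ (C ⊗ y) ⊜ 𝟘) refl _ C E ⟩
      0#                                              ∎
      where C = core a b (suc N ∸ suc r) (suc r ∸ suc r) s (suc r)

  -- With z = q^{s+1}, the sums satisfy
  --   grow_{b,a}(s+1) S(N+1, r, s+1) - shrink_{b,a}(s+1, N+1) S(N, r, s) = (b/a) z [N+1, r] grow(0),
  -- by telescoping with the certificate (x = q^k)
  --   certificate-s(k) = - (b/a) z [N+1-k, r-k] ratio_{s+1}(k) q^{(s+1)k} grow(k).
  -- The new summands carry (α(s+1); q)_k instead of (α(s); q)_k, so the k-th
  -- telescoping step is established after multiplication by 1 - q^{s+1}, both sides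
  -- becoming 1 - q^{r-k} times remainder-s(k); for k = r that factor vanishes.
  certificate-s : Carrier → Carrier → ℕ → ℕ → ℕ → ℕ → Carrier
  certificate-s a b N r s k = - (b / a * q ^ suc s * (core a b (suc N ∸ k) (r ∸ k) (suc s) k * grow a b k))

  remainder-s : Carrier → Carrier → ℕ → ℕ → ℕ → ℕ → Carrier
  remainder-s a b N r s k = (1# - b / a * q ^ suc s) * q ^ suc s * (1# - c * q ^ k) * term a b N r s k

  certificate-s-factor : ∀ {a b} s x → a ≉0 → b ≉0 →
    growAt b a (q ^ suc s) * x - b / a * q ^ suc s * growAt a b x
    ≈ - (b / a * q ^ suc s * (1# - α a b (suc s) * x)) * (1# - c * q ^ suc s * x)
  certificate-s-factor {a} {b} s x a≉0 b≉0 = begin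
    growAt b a z * x - b / a * z * growAt a b x
      ≈⟨ +-congˡ (-‿cong (solve 7 (λ a a' b b' c x z → (b ⊗ a' ⊗ z) ⊗ ((𝟙 ⊕ a ⊗ x) ⊗ (𝟙 ⊕ c ⊗ b' ⊗ x))
                                    ⊜ z ⊗ ((a' ⊗ (𝟙 ⊕ a ⊗ x)) ⊗ (b ⊗ (𝟙 ⊕ b' ⊗ (c ⊗ x)))))
                          refl a (a ⁻¹) b (b ⁻¹) c x z)) ⟩
    growAt b a z * x - z * ((a ⁻¹ * (1# + a * x)) * (b * (1# + b ⁻¹ * (c * x))))
      ≈⟨ +-congˡ (-‿cong (*-congˡ (*-cong (unit-absorb x (inverseˡ a≉0)) (unit-absorb (c * x) (⁻¹-inverse b b≉0))))) ⟩
    growAt b a z * x - z * ((a ⁻¹ + x) * (b + c * x))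
      ≈⟨ solve 5 (λ a' b c x z → (𝟙 ⊕ b ⊗ z) ⊗ (𝟙 ⊕ c ⊗ a' ⊗ z) ⊗ x ⊖ z ⊗ ((a' ⊕ x) ⊗ (b ⊕ c ⊗ x))
                                  ⊜ ⊝ (b ⊗ a' ⊗ z ⊖ x) ⊗ (𝟙 ⊖ c ⊗ z ⊗ x))
           refl (a ⁻¹) b c x z ⟩
    - (b / a * z - x) * (1# - c * z * x)
      ≈⟨ *-congʳ (-‿cong (sym (α-complement s x a≉0 b≉0))) ⟩
    - (b / a * z * (1# - α a b (suc s) * x)) * (1# - c * z * x) ∎
    where z = q ^ suc s

  -- the polynomial identity behind one telescoping step, after division by the
  -- common factor T (x = q^k, w = q^{r-k}, z = q^{s+1})
  identity-s : ∀ a b x w z T →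
    - ((b / a * z - 1#) * (1# - w * z) * T * (1# - c * z * x)) - shrinkAt b a z (x * (w * z)) * T * (1# - z)
    ≈ (1# - w) * ((1# - b / a * z) * z * (1# - c * x) * T)
  identity-s a b x w z T = solve 6
    (λ B c x w z T →
       ⊝ ((B ⊗ z ⊖ 𝟙) ⊗ (𝟙 ⊖ w ⊗ z) ⊗ T ⊗ (𝟙 ⊖ c ⊗ z ⊗ x)) ⊖ (𝟙 ⊖ B ⊗ z) ⊗ (𝟙 ⊖ c ⊗ (x ⊗ (w ⊗ z))) ⊗ T ⊗ (𝟙 ⊖ z)
       ⊜ (𝟙 ⊖ w) ⊗ ((𝟙 ⊖ B ⊗ z) ⊗ z ⊗ (𝟙 ⊖ c ⊗ x) ⊗ T))
    refl (b / a) c x w z T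

  core-absorb-s : ∀ a b j s k → FactorialsNonzero (suc (j +ℕ s)) →
    core a b (suc (j +ℕ s)) j (suc s) k * (1# - α a b (suc s) * q ^ k) * (1# - q ^ suc s)
    ≈ (1# - α a b (suc s)) * (1# - q ^ j * q ^ suc s) * summand a b (j +ℕ s) j s k
  core-absorb-s a b j s k fac≉0 = begin
    B₁ * ratio a b (suc s) k * P * g * v
      ≈⟨ solve 5 (λ B ρ P g v → B ⊗ ρ ⊗ P ⊗ g ⊗ v ⊜ (B ⊗ v) ⊗ (ρ ⊗ g) ⊗ P) refl B₁ _ P g v ⟩
    (B₁ * v) * (ratio a b (suc s) k * g) * P
      ≈⟨ *-congʳ (*-cong (qbinom-raise-top j s fac≉0) (ratio-absorb a b s k)) ⟩
    (B₀ * (1# - q ^ suc (j +ℕ s))) * ((1# - α a b (suc s)) * ratio a b s k) * P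
      ≈⟨ *-congʳ (*-congʳ (*-congˡ (+-congˡ (-‿cong (^-split j (suc s) (≡.sym (ℕₚ.+-suc j s))))))) ⟩
    (B₀ * (1# - q ^ j * q ^ suc s)) * ((1# - α a b (suc s)) * ratio a b s k) * P
      ≈⟨ solve 5 (λ B u h ρ P → (B ⊗ u) ⊗ (h ⊗ ρ) ⊗ P ⊜ h ⊗ u ⊗ (B ⊗ ρ ⊗ P)) refl B₀ _ _ _ P ⟩
    (1# - α a b (suc s)) * (1# - q ^ j * q ^ suc s) * summand a b (j +ℕ s) j s k ∎
    where
    B₀ = qbinom q (j +ℕ s) j
    B₁ = qbinom q (suc (j +ℕ s)) j
    P = q ^ (suc s *ℕ k)
    g = 1# - α a b (suc s) * q ^ k
    v = 1# - q ^ suc s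

  core-front-s : ∀ a b i s k → FactorialsNonzero (suc (i +ℕ s)) → den a b (suc k) ≉0 →
    core a b (suc (i +ℕ s)) i (suc s) (suc k) * grow a b (suc k) * (1# - q ^ suc s)
    ≈ (1# - α a b (suc s)) * (1# - q ^ suc i) * q ^ suc s * (1# - c * q ^ k) * summand a b (suc (i +ℕ s)) (suc i) s k
  core-front-s a b i s k fac≉0 den≉0 = begin
    B′ * ratio a b (suc s) (suc k) * q ^ (suc s *ℕ suc k) * grow a b (suc k) * v
      ≈⟨ solve 5 (λ B ρ P g v → B ⊗ ρ ⊗ P ⊗ g ⊗ v ⊜ (B ⊗ v) ⊗ (ρ ⊗ g) ⊗ P) refl B′ _ _ _ v ⟩
    (B′ * v) * (ratio a b (suc s) (suc k) * grow a b (suc k)) * q ^ (suc s *ℕ suc k)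
      ≈⟨ *-cong (*-cong (qbinom-lower i s fac≉0) (ratio-front a b s k den≉0)) (^-split (suc s) (suc s *ℕ k) (ℕₚ.*-suc (suc s) k)) ⟩
    (B₀ * (1# - q ^ suc i)) * (ratio a b s k * ((1# - c * q ^ k) * (1# - α a b (suc s)))) * (q ^ suc s * q ^ (suc s *ℕ k))
      ≈⟨ solve 7 (λ B u ρ g h z P → (B ⊗ u) ⊗ (ρ ⊗ (g ⊗ h)) ⊗ (z ⊗ P) ⊜ h ⊗ u ⊗ z ⊗ g ⊗ (B ⊗ ρ ⊗ P)) refl B₀ _ _ _ _ _ _ ⟩
    (1# - α a b (suc s)) * (1# - q ^ suc i) * q ^ suc s * (1# - c * q ^ k) * summand a b (suc (i +ℕ s)) (suc i) s k ∎
    where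
    B₀ = qbinom q (suc (i +ℕ s)) (suc i)
    B′ = qbinom q (suc (i +ℕ s)) i
    v = 1# - q ^ suc s

  step-s-term : ∀ a b N r s k → N ≡ r +ℕ s → k ≤ r → FactorialsNonzero (suc N) → a ≉0 → b ≉0 →
    (grow b a (suc s) * term a b (suc N) r (suc s) k - shrink b a (suc s) (suc N) * term a b N r s k
      + certificate-s a b N r s k) * (1# - q ^ suc s)
    ≈ (1# - q ^ (r ∸ k)) * remainder-s a b N r s k
  step-s-term a b N r s k N≡r+s k≤r fac≉0 a≉0 b≉0 = begin
    (E * t₁ - ρ * t₀ + G) * v
      ≈⟨ *-congʳ (+-congʳ (+-cong (*-congˡ (term-split a b (suc N) r (suc s) k)) (-‿cong (*-cong ρ≈ t₀≈)))) ⟩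
    (E * (C₁ * x) - shrinkAt b a z (x * (w * z)) * T₀ + - (B * z * (C₁ * growAt a b x))) * v
      ≈⟨ solve 9 (λ E C₁ x ρ T₀ B z e v → (E ⊗ (C₁ ⊗ x) ⊖ ρ ⊗ T₀ ⊕ ⊝ (B ⊗ z ⊗ (C₁ ⊗ e))) ⊗ v
                                         ⊜ C₁ ⊗ (E ⊗ x ⊖ B ⊗ z ⊗ e) ⊗ v ⊖ ρ ⊗ T₀ ⊗ v)
           refl E C₁ x _ T₀ B z _ v ⟩
    C₁ * (E * x - B * z * growAt a b x) * v - shrinkAt b a z (x * (w * z)) * T₀ * v
      ≈⟨ +-congʳ (*-congʳ (*-congˡ (certificate-s-factor s x a≉0 b≉0))) ⟩
    C₁ * (- (B * z * (1# - α₁ * x)) * (1# - c * z * x)) * v - shrinkAt b a z (x * (w * z)) * T₀ * v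
      ≈⟨ +-congʳ (solve 6 (λ C₁ B z h g v → C₁ ⊗ (⊝ (B ⊗ z ⊗ h) ⊗ g) ⊗ v ⊜ ⊝ (B ⊗ z ⊗ (C₁ ⊗ h ⊗ v) ⊗ g)) refl C₁ B z _ _ v) ⟩
    - (B * z * (C₁ * (1# - α₁ * x) * v) * (1# - c * z * x)) - shrinkAt b a z (x * (w * z)) * T₀ * v
      ≈⟨ +-congʳ (-‿cong (*-congʳ (*-congˡ C₁-absorb))) ⟩
    - (B * z * ((1# - α₁) * (1# - w * z) * T₀) * (1# - c * z * x)) - shrinkAt b a z (x * (w * z)) * T₀ * v
      ≈⟨ +-congʳ (-‿cong (solve 6 (λ B z h u T g → B ⊗ z ⊗ (h ⊗ u ⊗ T) ⊗ g ⊜ (B ⊗ z ⊗ h) ⊗ u ⊗ T ⊗ g) refl B z _ _ T₀ _)) ⟩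
    - (B * z * (1# - α₁) * (1# - w * z) * T₀ * (1# - c * z * x)) - shrinkAt b a z (x * (w * z)) * T₀ * v
      ≈⟨ +-congʳ (-‿cong (*-congʳ (*-congʳ (*-congʳ (α-complement₁ s a≉0 b≉0))))) ⟩
    - ((B * z - 1#) * (1# - w * z) * T₀ * (1# - c * z * x)) - shrinkAt b a z (x * (w * z)) * T₀ * v
      ≈⟨ identity-s a b x w z T₀ ⟩
    (1# - w) * ((1# - B * z) * z * (1# - c * x) * T₀)
      ≈⟨ *-congˡ (*-congˡ (sym t₀≈)) ⟩
    (1# - w) * remainder-s a b N r s k ∎
    where
    j = r ∸ k
    x = q ^ k
    w = q ^ j
    z = q ^ suc s
    v = 1# - z
    B = b / a
    α₁ = α a b (suc s)
    E = grow b a (suc s)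
    ρ = shrink b a (suc s) (suc N)
    t₁ = term a b (suc N) r (suc s) k
    t₀ = term a b N r s k
    G = certificate-s a b N r s k
    C₁ = core a b (suc N ∸ k) j (suc s) k
    T₀ = summand a b (j +ℕ s) j s k

    N≡ : N ≡ k +ℕ (j +ℕ s)
    N≡ = split-at N≡r+s k≤r
    1+N≡ : suc N ≡ k +ℕ suc (j +ℕ s)
    1+N≡ = ≡.trans (≡.cong suc N≡) (≡.sym (ℕₚ.+-suc k (j +ℕ s)))
    fac≉0′ : FactorialsNonzero (suc (j +ℕ s))
    fac≉0′ = factorials-≤ (ℕₚ.≤-trans (ℕₚ.m≤n+m _ k) (ℕₚ.≤-reflexive (≡.sym 1+N≡))) fac≉0

    t₀≈ : t₀ ≈ T₀
    t₀≈ = term-at a b N r s k (∸-of-split k N≡) ≡.refl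
    ρ≈ : ρ ≈ shrinkAt b a z (x * (w * z))
    ρ≈ = shrinkAt-cong b a refl (trans (^-split k (suc (j +ℕ s)) 1+N≡) (*-congˡ (^-split j (suc s) (≡.sym (ℕₚ.+-suc j s)))))
    C₁-absorb : C₁ * (1# - α₁ * x) * v ≈ (1# - α₁) * (1# - w * z) * T₀
    C₁-absorb = trans (*-congʳ (*-congʳ (core-≡ a b (suc s) k {i = j} (∸-of-split k 1+N≡) ≡.refl))) (core-absorb-s a b j s k fac≉0′)

  step-s-next : ∀ a b N r s k → N ≡ r +ℕ s → suc k ≤ r → FactorialsNonzero (suc N) → den a b (suc k) ≉0 → a ≉0 → b ≉0 →
    certificate-s a b N r s (suc k) * (1# - q ^ suc s) ≈ (1# - q ^ (r ∸ k)) * remainder-s a b N r s k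
  step-s-next a b N r s k N≡r+s k<r fac≉0 den≉0 a≉0 b≉0 = begin
    - (B * z * (C * grow a b (suc k))) * v
      ≈⟨ solve 5 (λ B z C g v → ⊝ (B ⊗ z ⊗ (C ⊗ g)) ⊗ v ⊜ ⊝ (B ⊗ z ⊗ (C ⊗ g ⊗ v))) refl B z C _ v ⟩
    - (B * z * (C * grow a b (suc k) * v))
      ≈⟨ -‿cong (*-congˡ C-front) ⟩
    - (B * z * ((1# - α₁) * (1# - w) * z * (1# - c * x) * T₀))
      ≈⟨ solve 6 (λ B z h u g T → ⊝ (B ⊗ z ⊗ (h ⊗ u ⊗ z ⊗ g ⊗ T)) ⊜ ⊝ (B ⊗ z ⊗ h) ⊗ (u ⊗ z ⊗ g ⊗ T)) refl B z _ _ _ T₀ ⟩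
    - (B * z * (1# - α₁)) * ((1# - w) * z * (1# - c * x) * T₀)
      ≈⟨ *-congʳ (-‿cong (α-complement₁ s a≉0 b≉0)) ⟩
    - (B * z - 1#) * ((1# - w) * z * (1# - c * x) * T₀)
      ≈⟨ solve 5 (λ B z w g T → ⊝ (B ⊗ z ⊖ 𝟙) ⊗ ((𝟙 ⊖ w) ⊗ z ⊗ g ⊗ T) ⊜ (𝟙 ⊖ w) ⊗ ((𝟙 ⊖ B ⊗ z) ⊗ z ⊗ g ⊗ T)) refl B z w _ T₀ ⟩
    (1# - w) * ((1# - B * z) * z * (1# - c * x) * T₀)
      ≈⟨ *-cong (+-congˡ (-‿cong (^-≡ q (≡.sym r∸k≡1+i)))) (*-congˡ (sym t₀≈)) ⟩
    (1# - q ^ (r ∸ k)) * remainder-s a b N r s k ∎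
    where
    i = r ∸ suc k
    x = q ^ k
    w = q ^ suc i
    z = q ^ suc s
    v = 1# - z
    B = b / a
    α₁ = α a b (suc s)
    C = core a b (N ∸ k) i (suc s) (suc k)
    T₀ = summand a b (suc (i +ℕ s)) (suc i) s k

    r∸k≡1+i : r ∸ k ≡ suc i
    r∸k≡1+i = ℕₚ.+-∸-assoc 1 k<r
    N≡ : N ≡ k +ℕ suc (i +ℕ s)
    N≡ = ≡.trans (split-at N≡r+s (ℕₚ.<⇒≤ k<r)) (≡.cong (λ t → k +ℕ (t +ℕ s)) r∸k≡1+i)
    fac≉0′ : FactorialsNonzero (suc (i +ℕ s))
    fac≉0′ = factorials-≤ (ℕₚ.m≤n⇒m≤1+n (ℕₚ.≤-trans (ℕₚ.m≤n+m _ k) (ℕₚ.≤-reflexive (≡.sym N≡)))) fac≉0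

    t₀≈ : term a b N r s k ≈ T₀
    t₀≈ = term-at a b N r s k (∸-of-split k N≡) r∸k≡1+i
    C-front : C * grow a b (suc k) * v ≈ (1# - α₁) * (1# - w) * z * (1# - c * x) * T₀
    C-front = trans (*-congʳ (*-congʳ (core-≡ a b (suc s) (suc k) {i = i} (∸-of-split k N≡) ≡.refl)))
                    (core-front-s a b i s k fac≉0′ den≉0)

  step-s : ∀ a b N r s → N ≡ r +ℕ s → FactorialsNonzero (suc N) → (∀ k → k ≤ r → den a b k ≉0) → a ≉0 → b ≉0 →
    grow b a (suc s) * sum a b (suc N) r (suc s) - shrink b a (suc s) (suc N) * sum a b N r s
    ≈ b / a * q ^ suc s * edge a b (suc N) r
  step-s a b N r s N≡r+s fac≉0 den≉0 a≉0 b≉0 = begin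
    E * sumTo r t₁ - ρ * sumTo r t₀
      ≈⟨ sym (sumTo-linear r E ρ t₁ t₀) ⟩
    sumTo r (λ k → E * t₁ k - ρ * t₀ k)
      ≈⟨ telescope r _ G 0# inner last ⟩
    0# - G 0
      ≈⟨ +-congˡ (-‿cong (-‿cong (*-congˡ (*-congʳ (core-zero a b (suc N) r (suc s)))))) ⟩
    0# - - (b / a * q ^ suc s * edge a b (suc N) r)
      ≈⟨ solve 1 (λ X → 𝟘 ⊖ ⊝ X ⊜ X) refl _ ⟩
    b / a * q ^ suc s * edge a b (suc N) r ∎
    where
    E = grow b a (suc s)
    ρ = shrink b a (suc s) (suc N)
    t₁ = term a b (suc N) r (suc s)
    t₀ = term a b N r s
    G = certificate-s a b N r s
    v≉0 : 1# - q ^ suc s ≉0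
    v≉0 = poch-factor-≉0 q q {s} ℕₚ.≤-refl (fac≉0 (suc s) (s≤s (ℕₚ.≤-trans (ℕₚ.m≤n+m s r) (ℕₚ.≤-reflexive (≡.sym N≡r+s)))))
    inner : ∀ k → k < r → E * t₁ k - ρ * t₀ k ≈ G (suc k) - G k
    inner k k<r = move-to-right (*-cancelʳ v≉0 (trans (step-s-term a b N r s k N≡r+s (ℕₚ.<⇒≤ k<r) fac≉0 a≉0 b≉0)
                                                 (sym (step-s-next a b N r s k N≡r+s k<r fac≉0 (den≉0 (suc k) k<r) a≉0 b≉0))))
    last : E * t₁ r - ρ * t₀ r ≈ 0# - G r
    last = move-to-right (*-cancelʳ v≉0 (begin
      (E * t₁ r - ρ * t₀ r + G r) * (1# - q ^ suc s)   ≈⟨ step-s-term a b N r s r N≡r+s ℕₚ.≤-refl fac≉0 a≉0 b≉0 ⟩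
      (1# - q ^ (r ∸ r)) * remainder-s a b N r s r      ≈⟨ *-congʳ (+-congˡ (-‿cong (^-≡ q (ℕₚ.n∸n≡0 r)))) ⟩
      (1# - 1#) * remainder-s a b N r s r               ≈⟨ solve 2 (λ X v → (𝟙 ⊖ 𝟙) ⊗ X ⊜ 𝟘 ⊗ v) refl _ _ ⟩
      0# * (1# - q ^ suc s)                             ∎))

  lhs-swap : ∀ a b N r s → lhs b a N s r ≈ - lhs a b N r s
  lhs-swap a b N r s = solve 4 (λ A B S T → A ⊗ S ⊖ B ⊗ T ⊜ ⊝ (B ⊗ T ⊖ A ⊗ S)) refl _ _ (sum b a N s r) (sum a b N r s)

  rhs-swap : ∀ a b r s → rhs-denominator a b r s ≉0 → rhs b a s r ≈ - rhs a b r s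
  rhs-swap a b r s den≉0 = begin
    (1# / a - 1# / b) * (rhs-numerator b a s r / rhs-denominator b a s r)
      ≈⟨ *-congˡ (*-cong numerator≈ (⁻¹-cong denominator≈ (≉0-resp (sym denominator≈) den≉0))) ⟩
    (1# / a - 1# / b) * (rhs-numerator a b r s / rhs-denominator a b r s)
      ≈⟨ solve 3 (λ A B X → (A ⊖ B) ⊗ X ⊜ ⊝ ((B ⊖ A) ⊗ X)) refl _ _ _ ⟩
    - rhs a b r s ∎
    where
    numerator≈ : rhs-numerator b a s r ≈ rhs-numerator a b r s
    numerator≈ = trans (*-congʳ (*-comm _ _)) (*-congˡ (reflexive (≡.cong (λ n → poch c q (suc n)) (ℕₚ.+-comm s r))))
    denominator≈ : rhs-denominator b a s r ≈ rhs-denominator a b r s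
    denominator≈ = solve 4 (λ A B C D → B ⊗ A ⊗ D ⊗ C ⊜ A ⊗ B ⊗ C ⊗ D) refl
      (poch (- (a * q)) q r) (poch (- (b * q)) q s) (poch (- (c / b)) q (r +ℕ 1)) (poch (- (c / a)) q (s +ℕ 1))

  rhs-step-r : ∀ a b N r s → N ≡ r +ℕ s → rhs-denominator a b (suc r) s ≉0 →
    grow a b (suc r) * rhs a b (suc r) s ≈ shrink a b (suc r) (suc N) * rhs a b r s
  rhs-step-r a b N r s N≡r+s den≉0 = begin
    grow a b (suc r) * (w * (X′ / Y′))    ≈⟨ solve 3 (λ g w Q → g ⊗ (w ⊗ Q) ⊜ w ⊗ (Q ⊗ g)) refl _ w _ ⟩
    w * (X′ / Y′ * grow a b (suc r))      ≈⟨ *-congˡ (quotient-step den≉0 X′≈ Y′≈) ⟩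
    w * (X / Y * shrink a b (suc r) (suc N))  ≈⟨ solve 3 (λ w Q h → w ⊗ (Q ⊗ h) ⊜ h ⊗ (w ⊗ Q)) refl w _ _ ⟩
    shrink a b (suc r) (suc N) * (w * (X / Y)) ∎
    where
    w = (1# / b) - (1# / a)
    X = rhs-numerator a b r s
    Y = rhs-denominator a b r s
    X′ = rhs-numerator a b (suc r) s
    Y′ = rhs-denominator a b (suc r) s
    X′≈ : X′ ≈ X * shrink a b (suc r) (suc N)
    X′≈ = begin
      poch (a * q / b) q r * (1# - a * q / b * q ^ r) * P₂ * (poch c q (suc (r +ℕ s)) * (1# - c * q ^ suc (r +ℕ s)))
        ≈⟨ solve 9 (λ P₁ a q b' x P₂ P₃ c y → P₁ ⊗ (𝟙 ⊖ a ⊗ q ⊗ b' ⊗ x) ⊗ P₂ ⊗ (P₃ ⊗ (𝟙 ⊖ c ⊗ y))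
                                             ⊜ (P₁ ⊗ P₂ ⊗ P₃) ⊗ ((𝟙 ⊖ a ⊗ b' ⊗ (q ⊗ x)) ⊗ (𝟙 ⊖ c ⊗ y)))
             refl (poch (a * q / b) q r) a q (b ⁻¹) (q ^ r) P₂ (poch c q (suc (r +ℕ s))) c (q ^ suc (r +ℕ s)) ⟩
      X * ((1# - a / b * q ^ suc r) * (1# - c * q ^ suc (r +ℕ s)))
        ≈⟨ *-congˡ (*-congˡ (+-congˡ (-‿cong (*-congˡ (^-≡ q (≡.cong suc (≡.sym N≡r+s))))))) ⟩
      X * shrink a b (suc r) (suc N) ∎
      where P₂ = poch (b * q / a) q s
    Y′≈ : Y′ ≈ Y * grow a b (suc r)
    Y′≈ = begin
      poch (- (a * q)) q r * (1# - - (a * q) * q ^ r) * P₂ * (poch (- (c / b)) q (r +ℕ 1) * (1# - - (c / b) * q ^ (r +ℕ 1))) * P₄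
        ≈⟨ *-congʳ (*-congˡ (*-congˡ (+-congˡ (-‿cong (*-congˡ (^-≡ q (ℕₚ.+-comm r 1))))))) ⟩
      poch (- (a * q)) q r * (1# - - (a * q) * q ^ r) * P₂ * (poch (- (c / b)) q (r +ℕ 1) * (1# - - (c / b) * q ^ suc r)) * P₄
        ≈⟨ solve 9 (λ P₁ a q x P₂ P₃ c b' P₄ → P₁ ⊗ (𝟙 ⊖ ⊝ (a ⊗ q) ⊗ x) ⊗ P₂ ⊗ (P₃ ⊗ (𝟙 ⊖ ⊝ (c ⊗ b') ⊗ (q ⊗ x))) ⊗ P₄
                                             ⊜ (P₁ ⊗ P₂ ⊗ P₃ ⊗ P₄) ⊗ ((𝟙 ⊕ a ⊗ (q ⊗ x)) ⊗ (𝟙 ⊕ c ⊗ b' ⊗ (q ⊗ x))))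
             refl (poch (- (a * q)) q r) a q (q ^ r) P₂ (poch (- (c / b)) q (r +ℕ 1)) c (b ⁻¹) P₄ ⟩
      Y * grow a b (suc r) ∎
      where
      P₂ = poch (- (b * q)) q s
      P₄ = poch (- (c / a)) q (s +ℕ 1)

  weight-absorb : ∀ {b} → b ≉0 → c + b ≉0 → (1# + b) / (c + b) * (1# + c / b * 1#) ≈ (1# + b) / b
  weight-absorb {b} b≉0 c+b≉0 = begin
    (1# + b) * (c + b) ⁻¹ * (1# + c * b ⁻¹ * 1#)
      ≈⟨ *-congˡ (solve 3 (λ b b' c → 𝟙 ⊕ c ⊗ b' ⊗ 𝟙 ⊜ c ⊗ b' ⊕ 𝟙) refl b (b ⁻¹) c) ⟩
    (1# + b) * (c + b) ⁻¹ * (c * b ⁻¹ + 1#)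
      ≈⟨ *-congˡ (+-congˡ (sym (⁻¹-inverse b b≉0))) ⟩
    (1# + b) * (c + b) ⁻¹ * (c * b ⁻¹ + b * b ⁻¹)
      ≈⟨ solve 4 (λ b b' c d → (𝟙 ⊕ b) ⊗ d ⊗ (c ⊗ b' ⊕ b ⊗ b') ⊜ (𝟙 ⊕ b) ⊗ b' ⊗ ((c ⊕ b) ⊗ d)) refl b (b ⁻¹) c ((c + b) ⁻¹) ⟩
    (1# + b) * b ⁻¹ * ((c + b) * (c + b) ⁻¹)
      ≈⟨ trans (*-congˡ (⁻¹-inverse (c + b) c+b≉0)) (*-identityʳ _) ⟩
    (1# + b) * b ⁻¹ ∎

  -- the boundary terms of the two recurrences cancel in the left-hand side
  edges-cancel : ∀ {a b} M j m y → M ≡ j +ℕ m → a ≉0 → b ≉0 → c + a ≉0 → c + b ≉0 → fac j * fac m ≉0 →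
    (1# + b) / (c + b) * (y * edge a b M j) ≈ (1# + a) / (c + a) * (a / b * y * edge b a M m)
  edges-cancel {a} {b} M j m y M≡j+m a≉0 b≉0 c+a≉0 c+b≉0 facs≉0 = begin
    (1# + b) / (c + b) * (y * (Q * ((1# + a * 1#) * (1# + c / b * 1#))))
      ≈⟨ solve 5 (λ A y Q u w′ → A ⊗ (y ⊗ (Q ⊗ (u ⊗ w′))) ⊜ (A ⊗ w′) ⊗ (y ⊗ Q ⊗ u)) refl _ y Q _ _ ⟩
    ((1# + b) / (c + b) * (1# + c / b * 1#)) * (y * Q * (1# + a * 1#))
      ≈⟨ *-congʳ (weight-absorb b≉0 c+b≉0) ⟩
    (1# + b) / b * (y * Q * (1# + a * 1#))
      ≈⟨ solve 5 (λ a b b' y Q → (𝟙 ⊕ b) ⊗ b' ⊗ (y ⊗ Q ⊗ (𝟙 ⊕ a ⊗ 𝟙)) ⊜ (𝟙 ⊕ a) ⊗ b' ⊗ y ⊗ Q ⊗ (𝟙 ⊕ b ⊗ 𝟙))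
           refl a b (b ⁻¹) y Q ⟩
    (1# + a) * b ⁻¹ * y * Q * (1# + b * 1#)
      ≈⟨ *-congʳ (*-congˡ Q≈Q′) ⟩
    (1# + a) * b ⁻¹ * y * Q′ * (1# + b * 1#)
      ≈⟨ sym other-side ⟩
    (1# + a) / (c + a) * (a / b * y * (Q′ * ((1# + b * 1#) * (1# + c / a * 1#)))) ∎
    where
    Q = qbinom q M j
    Q′ = qbinom q M m
    Q≈Q′ : Q ≈ Q′
    Q≈Q′ = begin
      qbinom q M j          ≈⟨ qbinom-≡ {i = j} M≡j+m ≡.refl ⟩
      qbinom q (j +ℕ m) j   ≈⟨ qbinom-symmetric j m facs≉0 ⟩
      qbinom q (m +ℕ j) m   ≈⟨ qbinom-≡ {i = m} (≡.trans (ℕₚ.+-comm m j) (≡.sym M≡j+m)) ≡.refl ⟩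
      qbinom q M m          ∎
    other-side : (1# + a) / (c + a) * (a / b * y * (Q′ * ((1# + b * 1#) * (1# + c / a * 1#))))
                 ≈ (1# + a) * b ⁻¹ * y * Q′ * (1# + b * 1#)
    other-side = begin
      (1# + a) / (c + a) * (a / b * y * (Q′ * ((1# + b * 1#) * (1# + c / a * 1#))))
        ≈⟨ solve 6 (λ A B Q u w' y → A ⊗ (B ⊗ y ⊗ (Q ⊗ (u ⊗ w'))) ⊜ (A ⊗ w') ⊗ (B ⊗ y ⊗ Q ⊗ u)) refl _ (a / b) Q′ _ _ y ⟩
      ((1# + a) / (c + a) * (1# + c / a * 1#)) * (a / b * y * Q′ * (1# + b * 1#))
        ≈⟨ *-congʳ (weight-absorb a≉0 c+a≉0) ⟩
      (1# + a) / a * (a / b * y * Q′ * (1# + b * 1#))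
        ≈⟨ solve 6 (λ a a' b' y Q u → (𝟙 ⊕ a) ⊗ a' ⊗ (a ⊗ b' ⊗ y ⊗ Q ⊗ u) ⊜ (a' ⊗ a) ⊗ ((𝟙 ⊕ a) ⊗ b' ⊗ y ⊗ Q ⊗ u))
             refl a (a ⁻¹) (b ⁻¹) y Q′ _ ⟩
      (a ⁻¹ * a) * ((1# + a) * b ⁻¹ * y * Q′ * (1# + b * 1#))
        ≈⟨ trans (*-congʳ (inverseˡ a≉0)) (*-identityˡ _) ⟩
      (1# + a) * b ⁻¹ * y * Q′ * (1# + b * 1#) ∎

  lhs-step-r : ∀ a b N r s → N ≡ r +ℕ s → Admissible a b (suc r) s →
    grow a b (suc r) * lhs a b (suc N) (suc r) s ≈ shrink a b (suc r) (suc N) * lhs a b N r s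
  lhs-step-r a b N r s N≡r+s adm = ≈-from-difference (begin
    g * (A * S₁ - B * T₁) - h * (A * S₀ - B * T₀)
      ≈⟨ solve 8 (λ g h A B S₁ T₁ S₀ T₀ → g ⊗ (A ⊗ S₁ ⊖ B ⊗ T₁) ⊖ h ⊗ (A ⊗ S₀ ⊖ B ⊗ T₀)
                                          ⊜ A ⊗ (g ⊗ S₁ ⊖ h ⊗ S₀) ⊖ B ⊗ (g ⊗ T₁ ⊖ h ⊗ T₀)) refl g h A B S₁ T₁ S₀ T₀ ⟩
    A * (g * S₁ - h * S₀) - B * (g * T₁ - h * T₀)
      ≈⟨ +-cong (*-congˡ (step-r a b N r s N≡r+s factorials′ den₁))
                (-‿cong (*-congˡ (step-s b a N s r (≡.trans N≡r+s (ℕₚ.+-comm r s)) factorials′ den₂ b≉0 a≉0))) ⟩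
    A * (q ^ suc r * edge a b (suc N) (suc r)) - B * (a / b * q ^ suc r * edge b a (suc N) s)
      ≈⟨ +-congʳ (edges-cancel (suc N) (suc r) s (q ^ suc r) (≡.cong suc N≡r+s) a≉0 b≉0 c+a≉0 c+b≉0 facs≉0) ⟩
    B * (a / b * q ^ suc r * edge b a (suc N) s) - B * (a / b * q ^ suc r * edge b a (suc N) s)
      ≈⟨ -‿inverseʳ _ ⟩
    0# ∎)
    where
    open Admissible adm
    g = grow a b (suc r)
    h = shrink a b (suc r) (suc N)
    A = (1# + b) / (c + b)
    B = (1# + a) / (c + a)
    S₁ = sum a b (suc N) (suc r) s
    S₀ = sum a b N r s
    T₁ = sum b a (suc N) s (suc r)
    T₀ = sum b a N s r
    factorials′ : FactorialsNonzero (suc N)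
    factorials′ n n≤ = factorials n (ℕₚ.≤-trans n≤ (ℕₚ.≤-reflexive (≡.cong suc N≡r+s)))
    facs≉0 : fac (suc r) * fac s ≉0
    facs≉0 = *-≉0 (factorials (suc r) (ℕₚ.m≤m+n (suc r) s)) (factorials s (ℕₚ.m≤n+m s (suc r)))

  lhs-step-s : ∀ a b N r s → N ≡ r +ℕ s → Admissible a b r (suc s) →
    grow b a (suc s) * lhs a b (suc N) r (suc s) ≈ shrink b a (suc s) (suc N) * lhs a b N r s
  lhs-step-s a b N r s N≡r+s adm = begin
    grow b a (suc s) * lhs a b (suc N) r (suc s)        ≈⟨ *-congˡ (lhs-swap b a (suc N) (suc s) r) ⟩
    grow b a (suc s) * - lhs b a (suc N) (suc s) r      ≈⟨ solve 2 (λ g L → g ⊗ ⊝ L ⊜ ⊝ (g ⊗ L)) refl _ _ ⟩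
    - (grow b a (suc s) * lhs b a (suc N) (suc s) r)    ≈⟨ -‿cong (lhs-step-r b a N s r (≡.trans N≡r+s (ℕₚ.+-comm r s)) (swap adm)) ⟩
    - (shrink b a (suc s) (suc N) * lhs b a N s r)      ≈⟨ -‿cong (*-congˡ (lhs-swap a b N r s)) ⟩
    - (shrink b a (suc s) (suc N) * - lhs a b N r s)    ≈⟨ solve 2 (λ h L → ⊝ (h ⊗ ⊝ L) ⊜ h ⊗ L) refl _ _ ⟩
    shrink b a (suc s) (suc N) * lhs a b N r s         ∎

  rhs-step-s : ∀ a b N r s → N ≡ r +ℕ s → Admissible a b r (suc s) →
    grow b a (suc s) * rhs a b r (suc s) ≈ shrink b a (suc s) (suc N) * rhs a b r s
  rhs-step-s a b N r s N≡r+s adm = begin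
    grow b a (suc s) * rhs a b r (suc s)        ≈⟨ *-congˡ (rhs-swap b a (suc s) r (rhs-denominator-≉0 (swap adm))) ⟩
    grow b a (suc s) * - rhs b a (suc s) r      ≈⟨ solve 2 (λ g R → g ⊗ ⊝ R ⊜ ⊝ (g ⊗ R)) refl _ _ ⟩
    - (grow b a (suc s) * rhs b a (suc s) r)    ≈⟨ -‿cong (rhs-step-r b a N s r (≡.trans N≡r+s (ℕₚ.+-comm r s)) (rhs-denominator-≉0 (swap adm))) ⟩
    - (shrink b a (suc s) (suc N) * rhs b a s r) ≈⟨ -‿cong (*-congˡ (rhs-swap a b r s (rhs-denominator-≉0 (swap (lower (swap adm)))))) ⟩
    - (shrink b a (suc s) (suc N) * - rhs a b r s) ≈⟨ solve 2 (λ h R → ⊝ (h ⊗ ⊝ R) ⊜ h ⊗ R) refl _ _ ⟩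
    shrink b a (suc s) (suc N) * rhs a b r s     ∎


  -- r = s = 0: both sides equal (a - b)(1 - c)/((c + a)(c + b))
  base : ∀ {a b} → Admissible a b 0 0 → lhs a b 0 0 0 ≈ rhs a b 0 0
  base {a} {b} adm = *-cancelʳ (rhs-denominator-≉0 adm) (begin
    ((1# + b) / (c + b) * term a b 0 0 0 0 - (1# + a) / (c + a) * term b a 0 0 0 0) * Y
      ≈⟨ *-cong (+-cong (*-congˡ (term-origin a b)) (-‿cong (*-congˡ (term-origin b a)))) Y≈ ⟩
    ((1# + b) / (c + b) * 1# - (1# + a) / (c + a) * 1#) * ((c + b) * b ⁻¹ * ((c + a) * a ⁻¹))
      ≈⟨ solve 7 (λ a b c b' a' d e → ((𝟙 ⊕ b) ⊗ d ⊗ 𝟙 ⊖ (𝟙 ⊕ a) ⊗ e ⊗ 𝟙) ⊗ ((c ⊕ b) ⊗ b' ⊗ ((c ⊕ a) ⊗ a'))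
                                       ⊜ (𝟙 ⊕ b) ⊗ (d ⊗ (c ⊕ b)) ⊗ b' ⊗ ((c ⊕ a) ⊗ a') ⊖ (𝟙 ⊕ a) ⊗ (e ⊗ (c ⊕ a)) ⊗ a' ⊗ ((c ⊕ b) ⊗ b'))
           refl a b c (b ⁻¹) (a ⁻¹) ((c + b) ⁻¹) ((c + a) ⁻¹) ⟩
    (1# + b) * ((c + b) ⁻¹ * (c + b)) * b ⁻¹ * ((c + a) * a ⁻¹) - (1# + a) * ((c + a) ⁻¹ * (c + a)) * a ⁻¹ * ((c + b) * b ⁻¹)
      ≈⟨ +-cong (*-congʳ (*-congʳ (*-congˡ (inverseˡ c+b≉0)))) (-‿cong (*-congʳ (*-congʳ (*-congˡ (inverseˡ c+a≉0))))) ⟩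
    (1# + b) * 1# * b ⁻¹ * ((c + a) * a ⁻¹) - (1# + a) * 1# * a ⁻¹ * ((c + b) * b ⁻¹)
      ≈⟨ solve 5 (λ a b c b' a' → (𝟙 ⊕ b) ⊗ 𝟙 ⊗ b' ⊗ ((c ⊕ a) ⊗ a') ⊖ (𝟙 ⊕ a) ⊗ 𝟙 ⊗ a' ⊗ ((c ⊕ b) ⊗ b')
                                   ⊜ ((a' ⊗ a) ⊗ b' ⊖ (b' ⊗ b) ⊗ a') ⊗ (𝟙 ⊖ c))
           refl a b c (b ⁻¹) (a ⁻¹) ⟩
    ((a ⁻¹ * a) * b ⁻¹ - (b ⁻¹ * b) * a ⁻¹) * (1# - c)
      ≈⟨ *-congʳ (+-cong (*-congʳ (inverseˡ a≉0)) (-‿cong (*-congʳ (inverseˡ b≉0)))) ⟩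
    (1# * b ⁻¹ - 1# * a ⁻¹) * (1# - c)
      ≈⟨ sym rhs-side ⟩
    rhs a b 0 0 * Y ∎)
    where
    open Admissible adm
    Y = rhs-denominator a b 0 0
    Y≈ : Y ≈ (c + b) * b ⁻¹ * ((c + a) * a ⁻¹)
    Y≈ = begin
      Y                                              ≈⟨ solve 3 (λ c b' a' → 𝟙 ⊗ 𝟙 ⊗ (𝟙 ⊗ (𝟙 ⊖ ⊝ (c ⊗ b') ⊗ 𝟙)) ⊗ (𝟙 ⊗ (𝟙 ⊖ ⊝ (c ⊗ a') ⊗ 𝟙))
                                                                         ⊜ (c ⊗ b' ⊕ 𝟙) ⊗ (c ⊗ a' ⊕ 𝟙)) refl c (b ⁻¹) (a ⁻¹) ⟩
      (c * b ⁻¹ + 1#) * (c * a ⁻¹ + 1#)              ≈⟨ sym (*-cong (+-congˡ (⁻¹-inverse b b≉0)) (+-congˡ (⁻¹-inverse a a≉0))) ⟩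
      (c * b ⁻¹ + b * b ⁻¹) * (c * a ⁻¹ + a * a ⁻¹)  ≈⟨ sym (*-cong (distribʳ _ _ _) (distribʳ _ _ _)) ⟩
      (c + b) * b ⁻¹ * ((c + a) * a ⁻¹)              ∎
    rhs-side : rhs a b 0 0 * Y ≈ (1# * b ⁻¹ - 1# * a ⁻¹) * (1# - c)
    rhs-side = begin
      (w * (X * Y ⁻¹)) * Y       ≈⟨ solve 4 (λ w X Y' Y → (w ⊗ (X ⊗ Y')) ⊗ Y ⊜ w ⊗ X ⊗ (Y' ⊗ Y)) refl w X (Y ⁻¹) Y ⟩
      w * X * (Y ⁻¹ * Y)         ≈⟨ *-congˡ (inverseˡ (rhs-denominator-≉0 adm)) ⟩
      w * X * 1#                 ≈⟨ solve 2 (λ w c → w ⊗ (𝟙 ⊗ 𝟙 ⊗ (𝟙 ⊗ (𝟙 ⊖ c ⊗ 𝟙))) ⊗ 𝟙 ⊜ w ⊗ (𝟙 ⊖ c)) refl w c ⟩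
      w * (1# - c)               ∎
      where
      w = 1# / b - 1# / a
      X = rhs-numerator a b 0 0

  corollary-induction : ∀ a b r s → Admissible a b r s → lhs a b (r +ℕ s) r s ≈ rhs a b r s
  corollary-induction a b zero zero adm = base adm
  corollary-induction a b (suc r) s adm =
    transfer (grow-≉0 a b r (Admissible.den₁ adm (suc r) ℕₚ.≤-refl))
             (lhs-step-r a b (r +ℕ s) r s ≡.refl adm)
             (rhs-step-r a b (r +ℕ s) r s ≡.refl (rhs-denominator-≉0 adm))
             (corollary-induction a b r s (lower adm))
  corollary-induction a b zero (suc s) adm =
    transfer (grow-≉0 b a s (Admissible.den₂ adm (suc s) ℕₚ.≤-refl))
             (lhs-step-s a b s 0 s ≡.refl adm)
             (rhs-step-s a b s 0 s ≡.refl adm)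
             (corollary-induction a b 0 s (swap (lower (swap adm))))

corollary3p1 : {ℓc ℓe : Level} (F : Field ℓc ℓe) →
  let open Field F in let open FieldOps F in
  (q a b c : Carrier) (r s : ℕ) →
  ¬ (q ≈ 0#) → ¬ (a ≈ 0#) → ¬ (b ≈ 0#) → ¬ (c ≈ 0#) →
  (∀ n → n ≤ r +ℕ s → ¬ (poch q q n ≈ 0#)) →
  ¬ (c + b ≈ 0#) → ¬ (c + a ≈ 0#) →
  (∀ k → k ≤ r → ¬ (poch (- (a * q)) q k ≈ 0#)) →
  (∀ k → k ≤ r → ¬ (poch (- (c * q / b)) q k ≈ 0#)) →
  (∀ k → k ≤ s → ¬ (poch (- (b * q)) q k ≈ 0#)) →
  (∀ k → k ≤ s → ¬ (poch (- (c * q / a)) q k ≈ 0#)) →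
  ¬ (poch (- (c / b)) q (r +ℕ 1) ≈ 0#) →
  ¬ (poch (- (c / a)) q (s +ℕ 1) ≈ 0#) →
  ((1# + b) / (c + b)) *
    sumTo r (λ k →
      qbinom q (r +ℕ s ∸ k) (r ∸ k) *
      ((poch c q k * poch (a * ((q ⁻¹) ^ s) / b) q k)
        / (poch (- (a * q)) q k * poch (- (c * q / b)) q k)) *
      q ^ ((s +ℕ 1) *ℕ k))
  - ((1# + a) / (c + a)) *
    sumTo s (λ k →
      qbinom q (r +ℕ s ∸ k) (s ∸ k) *
      ((poch c q k * poch (b * ((q ⁻¹) ^ r) / a) q k)
        / (poch (- (b * q)) q k * poch (- (c * q / a)) q k)) *
      q ^ ((r +ℕ 1) *ℕ k))
  ≈
  ((1# / b) - (1# / a)) *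
    ((poch (a * q / b) q r * poch (b * q / a) q s * poch c q (1 +ℕ r +ℕ s))
      / (poch (- (a * q)) q r * poch (- (b * q)) q s
          * poch (- (c / b)) q (r +ℕ 1) * poch (- (c / a)) q (s +ℕ 1)))

corollary3p1 F q a b c r s q≉0 a≉0 b≉0 _ factorials c+b≉0 c+a≉0 den₁a den₁c den₂b den₂c tail₁ tail₂ =
  corollary-induction a b r s (record
    { a≉0 = a≉0 ; b≉0 = b≉0 ; c+a≉0 = c+a≉0 ; c+b≉0 = c+b≉0
    ; factorials = factorials
    ; den₁ = λ k k≤r → *-≉0 (den₁a k k≤r) (den₁c k k≤r)
    ; den₂ = λ k k≤s → *-≉0 (den₂b k k≤s) (den₂c k k≤s)
    ; tail₁ = tail₁ ; tail₂ = tail₂ })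
  where
  open Corollary F q c q≉0
  open FieldLemmas F using (*-≉0)
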